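{- Let $f$ and $h$ be arithmetic functions with $f(1) = 1$, and let $g$ be the arithmetic function satisfying $f \ast g = h \ast \mu$. Then for all $n \geq 1$, \[ g(n) = \sum_{k=1}^n \left((p_k \ast \mu)(n) + (p_k \ast D_{f} \ast \mu)(n)\right) \left(h(k) + \sum_{s = \pm 1} \sum_{j=1}^{\left\lfloor \frac{\sqrt{24k+1}-s}{6} \right\rfloor} (-1)^j\, h\!\left(k-\frac{j(3j+s)}{2}\right)\right). \]
   Context: $(a\ast b)(n) := \sum_{d|n} a(d)b(n/d)$ is Dirichlet convolution and $\mu$ is the Möbius function. Arithmetic functions are defined on $\mathbb{Z}_{\ge1}$, and $h(0) := 0$. $p(m)$ is Euler's partition function with $p(m):=0$ for $m<0$, and $p_k(n) := p(n-k)$. Define $f_{\pm}(n) := f(n)$ for $n>1$, $f_{\pm}(1) := -1$; $\mathrm{ds}_{1,f}(n) := f_{\pm}(n)$ and $\mathrm{ds}_{j,f}(n) := \sum_{d|n,\ d>1} f(d)\, \mathrm{ds}_{j-1,f}(n/d)$ for $j>1$; and $D_f(m) := \sum_{j=1}^{m} \mathrm{ds}_{2j,f}(m)$. -}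

module Defs where

open import Level using (Level)
open import Data.Nat as ℕ using (ℕ; zero; suc; _∸_; _≤?_; _≟_)
open import Data.Nat.DivMod using (_/_)
open import Data.Nat.Divisibility using (_∣?_)
open import Data.Nat.Primality using (prime?)
open import Data.Bool using (Bool; true; false; if_then_else_)
open import Relation.Nullary.Decidable using (does; _×-dec_)
open import Algebra.Bundles using (CommutativeRing)

ℕsum : ℕ → (ℕ → ℕ) → ℕ
ℕsum zero    F = 0
ℕsum (suc n) F = ℕsum n F ℕ.+ F n

-- number of partitions of m into parts of size ≤ k:
-- Q 0 m = [m = 0],  Q (k+1) m = Σ_{i ≥ 0, i(k+1) ≤ m} Q k (m - i(k+1))
-- (classify by the multiplicity i of the part k+1)
partsLe : ℕ → ℕ → ℕ
partsLe zero    m = if does (m ≟ 0) then 1 else 0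
partsLe (suc k) m =
  ℕsum (suc m) (λ i → if does (i ℕ.* suc k ≤? m) then partsLe k (m ∸ i ℕ.* suc k) else 0)

partition : ℕ → ℕ
partition m = partsLe m m

isqrtUpTo : ℕ → ℕ → ℕ
isqrtUpTo x zero    = 0
isqrtUpTo x (suc r) = if does (suc r ℕ.* suc r ≤? x) then suc r else isqrtUpTo x r

isqrt : ℕ → ℕ
isqrt x = isqrtUpTo x x

ω : ℕ → ℕ
ω n = ℕsum (suc n) (λ q → if does (prime? q ×-dec (q ∣? n)) then 1 else 0)

squarefree : ℕ → Bool
squarefree n = does (ℕsum (suc n) (λ d → if does (2 ≤? d) then
                         (if does ((d ℕ.* d) ∣? n) then 1 else 0) else 0) ≟ 0)

-- Arithmetic functions with values in a commutative ring R
-- (an arithmetic function is a map ℕ → R; only its values at n ≥ 1 matter,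
--  except where the value at 0 is fixed by convention)

module _ {c ℓ : Level} (R : CommutativeRing c ℓ) where
  open CommutativeRing R

  natR : ℕ → Carrier
  natR zero    = 0#
  natR (suc n) = 1# + natR n

  sgnPow : ℕ → Carrier
  sgnPow zero    = 1#
  sgnPow (suc j) = - sgnPow j

  Σ₁ : ℕ → (ℕ → Carrier) → Carrier
  Σ₁ zero    F = 0#
  Σ₁ (suc n) F = Σ₁ n F + F (suc n)

  divSum : ℕ → (ℕ → ℕ → Carrier) → Carrier
  divSum n F = Σ₁ n (λ { zero → 0#
                       ; (suc k) → if does (suc k ∣? n) then F (suc k) (n / suc k) else 0# })

  divSum>1 : ℕ → (ℕ → ℕ → Carrier) → Carrier
  divSum>1 n F = Σ₁ n (λ { zero → 0# ; (suc zero) → 0#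
                         ; (suc k) → if does (suc k ∣? n) then F (suc k) (n / suc k) else 0# })

  _⋆_ : (ℕ → Carrier) → (ℕ → Carrier) → ℕ → Carrier
  (a ⋆ b) n = divSum n (λ d e → a d * b e)

  μ : ℕ → Carrier
  μ n = if squarefree n then sgnPow (ω n) else 0#

  pₖ : ℕ → ℕ → Carrier
  pₖ k n = if does (k ≤? n) then natR (partition (n ∸ k)) else 0#

  f± : (ℕ → Carrier) → ℕ → Carrier
  f± f n = if does (n ≟ 1) then - 1# else f n

  -- ds_{j,f};  ds 0 is unused (the paper starts at j = 1)
  ds : ℕ → (ℕ → Carrier) → ℕ → Carrier
  ds zero          f n = 0#
  ds (suc zero)    f n = f± f n
  ds (suc (suc j)) f n = divSum>1 n (λ d e → f d * ds (suc j) f e)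

  D : (ℕ → Carrier) → ℕ → Carrier
  D f m = Σ₁ m (λ j → ds (2 ℕ.* j) f m)

  -- upper limits ⌊(√(24k+1) - s)/6⌋ for s = +1 and s = -1
  -- (⌊(√x - s)/6⌋ = ⌊(⌊√x⌋ - s)/6⌋ for integer s; both are ≥ 0 here)
  bound+ : ℕ → ℕ
  bound+ k = (isqrt (24 ℕ.* k ℕ.+ 1) ∸ 1) / 6

  bound- : ℕ → ℕ
  bound- k = (isqrt (24 ℕ.* k ℕ.+ 1) ℕ.+ 1) / 6

  pent+ : ℕ → ℕ
  pent+ j = (j ℕ.* (3 ℕ.* j ℕ.+ 1)) / 2

  pent- : ℕ → ℕ
  pent- j = (j ℕ.* (3 ℕ.* j ∸ 1)) / 2

  -- h(k) + Σ_{s=±1} Σ_{j=1}^{⌊(√(24k+1)-s)/6⌋} (-1)^j h(k - j(3j+s)/2)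
  -- (for j within these bounds, j(3j+s)/2 ≤ k, so ∸ is exact subtraction)
  H : (ℕ → Carrier) → ℕ → Carrier
  H h k = h k + (Σ₁ (bound+ k) (λ j → sgnPow j * h (k ∸ pent+ j))
               + Σ₁ (bound- k) (λ j → sgnPow j * h (k ∸ pent- j)))

{-# OPTIONS --safe #-}
-- Writing f = δ + f₊ with f₊(1) = 0, one has ds_{j,f} = f₊^{⋆j} - f₊^{⋆(j-1)}, so the terms
-- f ⋆ ds_{2j,f} = f₊^{⋆(2j+1)} - f₊^{⋆(2j-1)} telescope; as f₊^{⋆k}(n) = 0 for k ≥ n, this gives
-- f ⋆ (δ + D_f) = δ, hence g = (δ + D_f) ⋆ h ⋆ μ = h ⋆ μ + (h ⋆ D_f) ⋆ μ.
-- By Euler's pentagonal number theorem H(k) is the k-th coefficient of h(x) ∏_{i ≥ 1} (1 - x^i), so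
-- Σ_k H(k) p(m - k) = h(m); expanding h in both convolutions this way gives the formula.
-- The pentagonal number theorem enters through Shanks' finite form, proved by induction on n,
--   Σ_{k ≤ n} (-1)^k x^{nk + k(k+1)/2} ∏_{k < i ≤ n} (1 - x^i) = Σ_{|j| ≤ n} (-1)^j x^{j(3j+1)/2}.
-- Below degree n + 1 only its term k = 0 survives, so applied to the generating function of
-- partitions into parts ≤ n it gives the theorem up to degree n.
module Submission where

open import Level using (Level)
open import Function using (_∘_)
open import Algebra.Bundles using (CommutativeRing)
open import Data.Nat as ℕ using (ℕ; zero; suc; _≤_; _<_; _≥_; z≤n; s≤s; _∸_; _≤?_)
import Data.Nat.Properties as ℕₚ
open import Data.Nat.Tactic.RingSolver using (solve-∀)
open import Data.Bool using (if_then_else_)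
open import Data.Sum using (inj₁; inj₂)
open import Data.Product using (_×_; _,_; proj₁; proj₂)
open import Data.Empty using (⊥-elim)
open import Data.Nat.DivMod using (_/_; n/1≡n)
open import Data.Nat.Divisibility using (_∣_; _∣?_; divides; quotient; n/m≡quotient; m∣n⇒n≡m*quotient; 1∣_)
open import Data.Maybe using (Maybe; just; nothing)
open import Data.Integer as ℤ using (ℤ; -[1+_])
import Data.Integer.Properties as ℤₚ
open import Data.Sign as Sign using (Sign)
import Algebra.Solver.Ring.AlmostCommutativeRing as ACR
open import Relation.Nullary using (Dec; yes; no; ¬_; does)
open import Relation.Nullary.Decidable using (dec-true; dec-false)
open import Relation.Binary.PropositionalEquality as ≡ using (_≡_; _≢_)
import Defs
open Defs using (ℕsum; partsLe; partition)

module BoundedPartitions where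
  open import Data.Nat using (_+_; _*_)

  ℕsum-cong : ∀ N {F G : ℕ → ℕ} → (∀ i → i < N → F i ≡ G i) → ℕsum N F ≡ ℕsum N G
  ℕsum-cong zero    F≡G = ≡.refl
  ℕsum-cong (suc N) F≡G =
    ≡.cong₂ _+_ (ℕsum-cong N (λ i i<N → F≡G i (ℕₚ.m≤n⇒m≤1+n i<N))) (F≡G N ℕₚ.≤-refl)

  ℕsum-shift : ∀ N (F : ℕ → ℕ) → ℕsum (suc N) F ≡ F 0 + ℕsum N (λ i → F (suc i))
  ℕsum-shift zero    F = ℕₚ.+-comm 0 (F 0)
  ℕsum-shift (suc N) F = ≡.trans (≡.cong (_+ F (suc N)) (ℕsum-shift N F)) (ℕₚ.+-assoc (F 0) _ _)

  ℕsum-pad : ∀ {N} M {F : ℕ → ℕ} → N ≤ M → (∀ i → N ≤ i → i < M → F i ≡ 0) → ℕsum N F ≡ ℕsum M F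
  ℕsum-pad zero z≤n _ = ≡.refl
  ℕsum-pad {N} (suc M) {F} N≤1+M zeros with ℕₚ.m≤n⇒m<n∨m≡n N≤1+M
  ... | inj₂ ≡.refl = ≡.refl
  ... | inj₁ (s≤s N≤M) = begin
    ℕsum N F            ≡⟨ ℕsum-pad M N≤M (λ i N≤i i<M → zeros i N≤i (ℕₚ.m≤n⇒m≤1+n i<M)) ⟩
    ℕsum M F            ≡⟨ ℕₚ.+-identityʳ _ ⟨
    ℕsum M F + 0        ≡⟨ ≡.cong (ℕsum M F +_) (zeros M N≤M ℕₚ.≤-refl) ⟨
    ℕsum (suc M) F      ∎
    where open ≡.≡-Reasoning

  if-false : ∀ {a} {A : Set a} (a? : Dec A) {x : ℕ} → ¬ A → (if does a? then x else 0) ≡ 0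
  if-false a? ¬a rewrite dec-false a? ¬a = ≡.refl

  if-⇔ : ∀ {a b} {A : Set a} {B : Set b} (a? : Dec A) (b? : Dec B) {x y : ℕ} →
    (A → B) → (B → A) → x ≡ y → (if does a? then x else 0) ≡ (if does b? then y else 0)
  if-⇔ (yes a) b? A⇒B _ x≡y rewrite dec-true b? (A⇒B a) = x≡y
  if-⇔ (no ¬a) b? _ B⇒A _ rewrite dec-false b? (¬a ∘ B⇒A) = ≡.refl

  partsLe-suc : ∀ k m →
    partsLe (suc k) m ≡ partsLe k m + (if does (suc k ≤? m) then partsLe (suc k) (m ∸ suc k) else 0)
  partsLe-suc k m = ≡.trans (ℕsum-shift m _) (≡.cong (partsLe k m +_) (positive-multiplicities (suc k ≤? m)))
    where
    term : ℕ → ℕ → ℕ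
    term m i = if does (i * suc k ≤? m) then partsLe k (m ∸ i * suc k) else 0

    positive-multiplicities : (k<m? : Dec (suc k ≤ m)) →
      ℕsum m (λ i → term m (suc i)) ≡ (if does k<m? then ℕsum (suc (m ∸ suc k)) (term (m ∸ suc k)) else 0)
    positive-multiplicities (no k≮m) = ℕsum-zero m
      where
      ℕsum-zero : ∀ N → ℕsum N (λ i → term m (suc i)) ≡ 0
      ℕsum-zero zero    = ≡.refl
      ℕsum-zero (suc N) = ≡.cong₂ _+_ (ℕsum-zero N)
        (if-false (suc N * suc k ≤? m) (λ le → k≮m (ℕₚ.≤-trans (ℕₚ.m≤m+n (suc k) (N * suc k)) le)))
    positive-multiplicities (yes k<m) = ≡.sym (begin
      ℕsum (suc m′) (term m′)
        ≡⟨ ℕsum-pad m m′<m (λ i m′<i _ →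
             if-false (i * suc k ≤? m′) (λ le → ℕₚ.<⇒≱ m′<i (ℕₚ.≤-trans (ℕₚ.m≤m*n i (suc k)) le))) ⟩
      ℕsum m (term m′)
        ≡⟨ ℕsum-cong m (λ i _ → if-⇔ (i * suc k ≤? m′) (suc i * suc k ≤? m) (fwd {i}) (bwd {i})
             (≡.cong (partsLe k) (ℕₚ.∸-+-assoc m (suc k) (i * suc k)))) ⟩
      ℕsum m (λ i → term m (suc i)) ∎)
      where
      open ≡.≡-Reasoning
      m′ : ℕ
      m′ = m ∸ suc k
      m′<m : m′ < m
      m′<m = ℕₚ.∸-monoʳ-< (s≤s z≤n) k<m
      fwd : ∀ {i} → i * suc k ≤ m′ → suc i * suc k ≤ m
      fwd le = ≡.subst (_ ≤_) (ℕₚ.m+[n∸m]≡n k<m) (ℕₚ.+-monoʳ-≤ (suc k) le)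
      bwd : ∀ {i} → suc i * suc k ≤ m → i * suc k ≤ m′
      bwd {i} le = ≡.subst (_≤ m′) (ℕₚ.m+n∸m≡n (suc k) (i * suc k)) (ℕₚ.∸-monoˡ-≤ (suc k) le)

  partsLe-stable : ∀ {k m} → m ≤ k → partsLe k m ≡ partition m
  partsLe-stable {k} {m} m≤k with ℕₚ.m≤n⇒m<n∨m≡n m≤k
  ... | inj₂ ≡.refl = ≡.refl
  ... | inj₁ m<k with k
  ...   | suc k′ = begin
    partsLe (suc k′) m    ≡⟨ partsLe-suc k′ m ⟩
    partsLe k′ m + _      ≡⟨ ≡.cong (partsLe k′ m +_) (if-false (suc k′ ≤? m) (ℕₚ.<⇒≱ m<k)) ⟩
    partsLe k′ m + 0      ≡⟨ ℕₚ.+-identityʳ _ ⟩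
    partsLe k′ m          ≡⟨ partsLe-stable (ℕₚ.≤-pred m<k) ⟩
    partition m           ∎
    where open ≡.≡-Reasoning

module PentagonalNumbers where
  open import Data.Nat using (_+_; _*_)
  open import Data.Nat.DivMod using (_/_; m*n/n≡m; /-monoˡ-≤)
  open Defs using (isqrt; isqrtUpTo; pent+; pent-; bound+; bound-)
  open ≡.≡-Reasoning

  triangle : ℕ → ℕ
  triangle zero    = 0
  triangle (suc k) = triangle k + suc k

  shanksExponent : ℕ → ℕ → ℕ
  shanksExponent n k = n * k + triangle k

  pentagonal⁺ : ℕ → ℕ
  pentagonal⁺ j = shanksExponent j j

  pentagonal⁻ : ℕ → ℕ
  pentagonal⁻ zero    = 0
  pentagonal⁻ (suc j) = j * suc j + triangle (suc j)

  triangle-double : ∀ j → triangle j * 2 ≡ j * suc j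
  triangle-double zero    = ≡.refl
  triangle-double (suc j) = begin
    (triangle j + suc j) * 2         ≡⟨ ℕₚ.*-distribʳ-+ 2 (triangle j) (suc j) ⟩
    triangle j * 2 + suc j * 2       ≡⟨ ≡.cong (_+ suc j * 2) (triangle-double j) ⟩
    j * suc j + suc j * 2            ≡⟨ lemma j ⟩
    suc j * suc (suc j)              ∎
    where
    lemma : ∀ j → j * suc j + suc j * 2 ≡ suc j * suc (suc j)
    lemma = solve-∀

  pentagonal⁺-double : ∀ j → pentagonal⁺ j * 2 ≡ j * (3 * j + 1)
  pentagonal⁺-double j = begin
    (j * j + triangle j) * 2         ≡⟨ ℕₚ.*-distribʳ-+ 2 (j * j) (triangle j) ⟩
    j * j * 2 + triangle j * 2       ≡⟨ ≡.cong (j * j * 2 +_) (triangle-double j) ⟩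
    j * j * 2 + j * suc j            ≡⟨ lemma j ⟩
    j * (3 * j + 1)                  ∎
    where
    lemma : ∀ j → j * j * 2 + j * suc j ≡ j * (3 * j + 1)
    lemma = solve-∀

  pentagonal⁻-double : ∀ i → pentagonal⁻ (suc i) * 2 ≡ suc i * (2 + 3 * i)
  pentagonal⁻-double i = begin
    (i * suc i + triangle (suc i)) * 2     ≡⟨ ℕₚ.*-distribʳ-+ 2 (i * suc i) (triangle (suc i)) ⟩
    i * suc i * 2 + triangle (suc i) * 2   ≡⟨ ≡.cong (i * suc i * 2 +_) (triangle-double (suc i)) ⟩
    i * suc i * 2 + suc i * suc (suc i)    ≡⟨ lemma i ⟩
    suc i * (2 + 3 * i)                    ∎
    where
    lemma : ∀ i → i * suc i * 2 + suc i * suc (suc i) ≡ suc i * (2 + 3 * i)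
    lemma = solve-∀

  pent+≡pentagonal⁺ : ∀ {c ℓ} (R : CommutativeRing c ℓ) j → pent+ R j ≡ pentagonal⁺ j
  pent+≡pentagonal⁺ R j = ≡.trans (≡.cong (_/ 2) (≡.sym (pentagonal⁺-double j))) (m*n/n≡m (pentagonal⁺ j) 2)

  pent-≡pentagonal⁻ : ∀ {c ℓ} (R : CommutativeRing c ℓ) j → pent- R j ≡ pentagonal⁻ j
  pent-≡pentagonal⁻ R zero    = ≡.refl
  pent-≡pentagonal⁻ R (suc i) = begin
    (suc i * (3 * suc i ∸ 1)) / 2     ≡⟨ ≡.cong (λ z → (suc i * (z ∸ 1)) / 2) (ℕₚ.*-suc 3 i) ⟩
    (suc i * (2 + 3 * i)) / 2         ≡⟨ ≡.cong (_/ 2) (pentagonal⁻-double i) ⟨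
    (pentagonal⁻ (suc i) * 2) / 2     ≡⟨ m*n/n≡m (pentagonal⁻ (suc i)) 2 ⟩
    pentagonal⁻ (suc i)               ∎

  isqrtUpTo-≥ : ∀ x u r → r ≤ u → r * r ≤ x → r ≤ isqrtUpTo x u
  isqrtUpTo-≥ x zero    r r≤u r²≤x = r≤u
  isqrtUpTo-≥ x (suc u) r r≤u r²≤x = split (suc u * suc u ≤? x)
    where
    split : (d : Dec (suc u * suc u ≤ x)) → r ≤ (if does d then suc u else isqrtUpTo x u)
    split (yes _) = r≤u
    split (no u²≰x) =
      isqrtUpTo-≥ x u r (ℕₚ.≤-pred (ℕₚ.≤∧≢⇒< r≤u (λ r≡u → u²≰x (≡.subst (λ z → z * z ≤ x) r≡u r²≤x)))) r²≤x

  isqrt-≥ : ∀ x r → r * r ≤ x → r ≤ isqrt x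
  isqrt-≥ x zero    _    = z≤n
  isqrt-≥ x (suc r) r²≤x = isqrtUpTo-≥ x x (suc r) (ℕₚ.≤-trans (ℕₚ.m≤m*n (suc r) (suc r)) r²≤x) r²≤x

  -- The bounds rest on (6j + 1)² = 24·j(3j+1)/2 + 1 and (6j - 1)² = 24·j(3j-1)/2 + 1.
  pentagonal⁺-≤⇒≤bound+ : ∀ {c ℓ} (R : CommutativeRing c ℓ) j k → pentagonal⁺ j ≤ k → j ≤ bound+ R k
  pentagonal⁺-≤⇒≤bound+ R j k p≤k =
    ≡.subst (_≤ bound+ R k) (m*n/n≡m j 6) (/-monoˡ-≤ 6 (ℕₚ.∸-monoˡ-≤ 1 (isqrt-≥ (24 * k + 1) (suc (j * 6)) r²≤24k+1)))
    where
    square : suc (j * 6) * suc (j * 6) ≡ 24 * pentagonal⁺ j + 1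
    square = ≡.trans (lemma j) (≡.trans (≡.cong (λ z → 12 * z + 1) (≡.sym (pentagonal⁺-double j))) (lemma′ (pentagonal⁺ j)))
      where
      lemma : ∀ j → suc (j * 6) * suc (j * 6) ≡ 12 * (j * (3 * j + 1)) + 1
      lemma = solve-∀
      lemma′ : ∀ p → 12 * (p * 2) + 1 ≡ 24 * p + 1
      lemma′ = solve-∀
    r²≤24k+1 : suc (j * 6) * suc (j * 6) ≤ 24 * k + 1
    r²≤24k+1 = ≡.subst (_≤ 24 * k + 1) (≡.sym square) (ℕₚ.+-monoˡ-≤ 1 (ℕₚ.*-monoʳ-≤ 24 p≤k))

  pentagonal⁻-≤⇒≤bound- : ∀ {c ℓ} (R : CommutativeRing c ℓ) i k → pentagonal⁻ (suc i) ≤ k → suc i ≤ bound- R k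
  pentagonal⁻-≤⇒≤bound- R i k p≤k =
    ≡.subst (_≤ bound- R k) (m*n/n≡m (suc i) 6)
      (/-monoˡ-≤ 6 (≡.subst (_≤ isqrt (24 * k + 1) + 1) (root+1 i) (ℕₚ.+-monoˡ-≤ 1 (isqrt-≥ (24 * k + 1) r r²≤24k+1))))
    where
    r : ℕ
    r = i * 6 + 5
    root+1 : ∀ i → (i * 6 + 5) + 1 ≡ suc i * 6
    root+1 = solve-∀
    square : r * r ≡ 24 * pentagonal⁻ (suc i) + 1
    square = ≡.trans (lemma i) (≡.trans (≡.cong (λ z → 12 * z + 1) (≡.sym (pentagonal⁻-double i)))
        (lemma′ (pentagonal⁻ (suc i))))
      where
      lemma : ∀ i → (i * 6 + 5) * (i * 6 + 5) ≡ 12 * (suc i * (2 + 3 * i)) + 1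
      lemma = solve-∀
      lemma′ : ∀ p → 12 * (p * 2) + 1 ≡ 24 * p + 1
      lemma′ = solve-∀
    r²≤24k+1 : r * r ≤ 24 * k + 1
    r²≤24k+1 = ≡.subst (_≤ 24 * k + 1) (≡.sym square) (ℕₚ.+-monoˡ-≤ 1 (ℕₚ.*-monoʳ-≤ 24 p≤k))

  j≤pentagonal⁺ : ∀ j → j ≤ pentagonal⁺ j
  j≤pentagonal⁺ zero    = z≤n
  j≤pentagonal⁺ (suc i) = ℕₚ.≤-trans (ℕₚ.m≤m+n (suc i) (i * suc i)) (ℕₚ.m≤m+n (suc i * suc i) (triangle (suc i)))

  j≤pentagonal⁻ : ∀ j → j ≤ pentagonal⁻ j
  j≤pentagonal⁻ zero    = z≤n
  j≤pentagonal⁻ (suc i) = ℕₚ.≤-trans (ℕₚ.m≤n+m (suc i) (triangle i)) (ℕₚ.m≤n+m (triangle i + suc i) (i * suc i))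

module RingValued {c ℓ} (R : CommutativeRing c ℓ) where
  open CommutativeRing R hiding (zero)
  open import Algebra.Properties.Ring ring
  open import Algebra.Properties.CommutativeSemigroup +-commutativeSemigroup using (interchange)
  open import Relation.Binary.Reasoning.Setoid setoid
  open Defs hiding (Σ₁; _⋆_)
  open PentagonalNumbers

  natR-+ : ∀ m n → natR R (m ℕ.+ n) ≈ natR R m + natR R n
  natR-+ zero    n = sym (+-identityˡ _)
  natR-+ (suc m) n = trans (+-congˡ (natR-+ m n)) (sym (+-assoc _ _ _))

  natR-* : ∀ m n → natR R (m ℕ.* n) ≈ natR R m * natR R n
  natR-* zero    n = sym (zeroˡ _)
  natR-* (suc m) n = begin
    natR R (n ℕ.+ m ℕ.* n)              ≈⟨ natR-+ n (m ℕ.* n) ⟩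
    natR R n + natR R (m ℕ.* n)         ≈⟨ +-cong (*-identityˡ _) (sym (natR-* m n)) ⟨
    1# * natR R n + natR R m * natR R n ≈⟨ distribʳ _ _ _ ⟨
    (1# + natR R m) * natR R n          ∎

  intR : ℤ → Carrier
  intR (ℤ.+ n)    = natR R n
  intR -[1+ n ] = - natR R (suc n)

  intR-⊖ : ∀ m n → intR (m ℤ.⊖ n) ≈ natR R m - natR R n
  intR-⊖ m       zero    = sym (trans (+-congˡ -0#≈0#) (+-identityʳ _))
  intR-⊖ zero    (suc n) = sym (+-identityˡ _)
  intR-⊖ (suc m) (suc n) = begin
    intR (suc m ℤ.⊖ suc n)               ≡⟨ ≡.cong intR (ℤₚ.[1+m]⊖[1+n]≡m⊖n m n) ⟩
    intR (m ℤ.⊖ n)                       ≈⟨ intR-⊖ m n ⟩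
    natR R m - natR R n                ≈⟨ +-identityˡ _ ⟨
    0# + (natR R m - natR R n)         ≈⟨ +-congʳ (-‿inverseʳ 1#) ⟨
    (1# - 1#) + (natR R m - natR R n)  ≈⟨ interchange _ _ _ _ ⟩
    (1# + natR R m) + (- 1# - natR R n) ≈⟨ +-congˡ (-‿+-comm _ _) ⟩
    (1# + natR R m) - (1# + natR R n)  ∎

  signed : Sign → Carrier → Carrier
  signed Sign.+ x = x
  signed Sign.- x = - x

  signed-cong : ∀ s {x y} → x ≈ y → signed s x ≈ signed s y
  signed-cong Sign.+ x≈y = x≈y
  signed-cong Sign.- x≈y = -‿cong x≈y

  signed-* : ∀ s t x y → signed (s Sign.* t) (x * y) ≈ signed s x * signed t y
  signed-* Sign.- Sign.- x y = trans (sym (-‿involutive _)) (trans (-‿cong (-‿distribˡ-* _ _)) (-‿distribʳ-* _ _))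
  signed-* Sign.- Sign.+ x y = -‿distribˡ-* _ _
  signed-* Sign.+ Sign.- x y = -‿distribʳ-* _ _
  signed-* Sign.+ Sign.+ x y = refl

  intR-◃ : ∀ s n → intR (s ℤ.◃ n) ≈ signed s (natR R n)
  intR-◃ Sign.- zero    = sym -0#≈0#
  intR-◃ Sign.+ zero    = refl
  intR-◃ Sign.- (suc n) = refl
  intR-◃ Sign.+ (suc n) = refl

  intR-signAbs : ∀ i → intR i ≈ signed (ℤ.sign i) (natR R ℤ.∣ i ∣)
  intR-signAbs i = trans (reflexive (≡.cong intR (≡.sym (ℤₚ.◃-inverse i)))) (intR-◃ (ℤ.sign i) ℤ.∣ i ∣)

  intR-* : ∀ i j → intR (i ℤ.* j) ≈ intR i * intR j
  intR-* i j = begin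
    intR (i ℤ.* j)                                      ≈⟨ intR-◃ (s Sign.* t) (ℤ.∣ i ∣ ℕ.* ℤ.∣ j ∣) ⟩
    signed (s Sign.* t) (natR R (ℤ.∣ i ∣ ℕ.* ℤ.∣ j ∣))  ≈⟨ signed-cong (s Sign.* t) (natR-* ℤ.∣ i ∣ ℤ.∣ j ∣) ⟩
    signed (s Sign.* t) (natR R ℤ.∣ i ∣ * natR R ℤ.∣ j ∣) ≈⟨ signed-* s t _ _ ⟩
    signed s (natR R ℤ.∣ i ∣) * signed t (natR R ℤ.∣ j ∣) ≈⟨ *-cong (intR-signAbs i) (intR-signAbs j) ⟨
    intR i * intR j                                     ∎
    where
    s t : Sign
    s = ℤ.sign i
    t = ℤ.sign j

  intR-neg : ∀ i → intR (ℤ.- i) ≈ - intR i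
  intR-neg -[1+ n ]    = sym (-‿involutive _)
  intR-neg (ℤ.+ zero)    = sym -0#≈0#
  intR-neg (ℤ.+ suc n)   = refl

  intR-+ : ∀ i j → intR (i ℤ.+ j) ≈ intR i + intR j
  intR-+ -[1+ m ] -[1+ n ] = begin
    - natR R (suc (suc (m ℕ.+ n)))      ≡⟨ ≡.cong (λ k → - natR R (suc k)) (≡.sym (ℕₚ.+-suc m n)) ⟩
    - natR R (suc m ℕ.+ suc n)          ≈⟨ -‿cong (natR-+ (suc m) (suc n)) ⟩
    - (natR R (suc m) + natR R (suc n)) ≈⟨ -‿+-comm _ _ ⟨
    - natR R (suc m) + - natR R (suc n) ∎
  intR-+ -[1+ m ] (ℤ.+ n)    = trans (intR-⊖ n (suc m)) (+-comm _ _)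
  intR-+ (ℤ.+ m)    -[1+ n ] = intR-⊖ m (suc n)
  intR-+ (ℤ.+ m)    (ℤ.+ n)    = natR-+ m n

  intR-homomorphism : ℤ.+-*-rawRing ACR.-Raw-AlmostCommutative⟶ ACR.fromCommutativeRing R
  intR-homomorphism = record
    { ⟦_⟧ = intR ; +-homo = intR-+ ; *-homo = intR-* ; -‿homo = intR-neg ; 0-homo = refl ; 1-homo = +-identityʳ _ }

  intR-≟ : ∀ (i j : ℤ) → Maybe (intR i ≈ intR j)
  intR-≟ i j with i ℤ.≟ j
  ... | yes ≡.refl = just refl
  ... | no _       = nothing

  open import Algebra.Solver.Ring ℤ.+-*-rawRing (ACR.fromCommutativeRing R) intR-homomorphism intR-≟
    using (solve; _:+_; _:-_; _:*_; :-_; _:=_; con)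

  Σ₁ : ℕ → (ℕ → Carrier) → Carrier
  Σ₁ = Defs.Σ₁ R

  Σ₁-cong-on : ∀ N {F G : ℕ → Carrier} → (∀ i → 1 ≤ i → i ≤ N → F i ≈ G i) → Σ₁ N F ≈ Σ₁ N G
  Σ₁-cong-on zero    F≈G = refl
  Σ₁-cong-on (suc N) F≈G =
    +-cong (Σ₁-cong-on N (λ i 1≤i i≤N → F≈G i 1≤i (ℕₚ.m≤n⇒m≤1+n i≤N))) (F≈G (suc N) (s≤s z≤n) ℕₚ.≤-refl)

  Σ₁-cong : ∀ N {F G : ℕ → Carrier} → (∀ i → F i ≈ G i) → Σ₁ N F ≈ Σ₁ N G
  Σ₁-cong N F≈G = Σ₁-cong-on N (λ i _ _ → F≈G i)

  Σ₁-zero : ∀ N {F : ℕ → Carrier} → (∀ i → 1 ≤ i → i ≤ N → F i ≈ 0#) → Σ₁ N F ≈ 0#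
  Σ₁-zero zero    F≈0 = refl
  Σ₁-zero (suc N) F≈0 =
    trans (+-cong (Σ₁-zero N (λ i 1≤i i≤N → F≈0 i 1≤i (ℕₚ.m≤n⇒m≤1+n i≤N))) (F≈0 (suc N) (s≤s z≤n) ℕₚ.≤-refl)) (+-identityʳ _)

  Σ₁-+ : ∀ N (F G : ℕ → Carrier) → Σ₁ N (λ i → F i + G i) ≈ Σ₁ N F + Σ₁ N G
  Σ₁-+ zero    F G = sym (+-identityʳ _)
  Σ₁-+ (suc N) F G = trans (+-congʳ (Σ₁-+ N F G)) (interchange _ _ _ _)

  Σ₁-neg : ∀ N (F : ℕ → Carrier) → - Σ₁ N F ≈ Σ₁ N (λ i → - F i)
  Σ₁-neg zero    F = -0#≈0#
  Σ₁-neg (suc N) F = trans (sym (-‿+-comm _ _)) (+-congʳ (Σ₁-neg N F))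

  Σ₁-*ˡ : ∀ N x (F : ℕ → Carrier) → x * Σ₁ N F ≈ Σ₁ N (λ i → x * F i)
  Σ₁-*ˡ zero    x F = zeroʳ x
  Σ₁-*ˡ (suc N) x F = trans (distribˡ _ _ _) (+-congʳ (Σ₁-*ˡ N x F))

  Σ₁-*ʳ : ∀ N x (F : ℕ → Carrier) → Σ₁ N F * x ≈ Σ₁ N (λ i → F i * x)
  Σ₁-*ʳ N x F = trans (*-comm _ _) (trans (Σ₁-*ˡ N x F) (Σ₁-cong N (λ i → *-comm _ _)))

  Σ₁-swap : ∀ N M (F : ℕ → ℕ → Carrier) → Σ₁ N (λ i → Σ₁ M (F i)) ≈ Σ₁ M (λ j → Σ₁ N (λ i → F i j))
  Σ₁-swap zero    M F = sym (Σ₁-zero M (λ _ _ _ → refl))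
  Σ₁-swap (suc N) M F = trans (+-congʳ (Σ₁-swap N M F)) (sym (Σ₁-+ M _ _))

  Σ₁-pad : ∀ {N} M {F : ℕ → Carrier} → N ≤ M → (∀ i → N < i → i ≤ M → F i ≈ 0#) → Σ₁ N F ≈ Σ₁ M F
  Σ₁-pad zero z≤n _ = refl
  Σ₁-pad {N} (suc M) {F} N≤1+M zeros with ℕₚ.m≤n⇒m<n∨m≡n N≤1+M
  ... | inj₂ ≡.refl = refl
  ... | inj₁ (s≤s N≤M) = begin
    Σ₁ N F         ≈⟨ Σ₁-pad M N≤M (λ i N<i i≤M → zeros i N<i (ℕₚ.m≤n⇒m≤1+n i≤M)) ⟩
    Σ₁ M F         ≈⟨ +-identityʳ _ ⟨
    Σ₁ M F + 0#    ≈⟨ +-congˡ (zeros (suc M) (s≤s N≤M) ℕₚ.≤-refl) ⟨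
    Σ₁ (suc M) F   ∎

  Σ₁-pad-both : ∀ N M {F : ℕ → Carrier} → (∀ i → N < i → F i ≈ 0#) → (∀ i → M < i → F i ≈ 0#) → Σ₁ N F ≈ Σ₁ M F
  Σ₁-pad-both N M zerosN zerosM with ℕₚ.≤-total N M
  ... | inj₁ N≤M = Σ₁-pad M N≤M (λ i N<i _ → zerosN i N<i)
  ... | inj₂ M≤N = sym (Σ₁-pad N M≤N (λ i M<i _ → zerosM i M<i))

  Σ₁-single : ∀ N k {F : ℕ → Carrier} → 1 ≤ k → k ≤ N → (∀ i → 1 ≤ i → i ≤ N → i ≢ k → F i ≈ 0#) → Σ₁ N F ≈ F k
  Σ₁-single zero    (suc k) _ () _
  Σ₁-single (suc N) k {F} 1≤k k≤1+N others with k ℕ.≟ suc N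
  ... | yes ≡.refl = trans (+-congʳ (Σ₁-zero N (λ i 1≤i i≤N → others i 1≤i (ℕₚ.m≤n⇒m≤1+n i≤N) (ℕₚ.<⇒≢ (s≤s i≤N)))))
      (+-identityˡ _)
  ... | no k≢1+N = trans
    (+-cong (Σ₁-single N k 1≤k (ℕₚ.≤-pred (ℕₚ.≤∧≢⇒< k≤1+N k≢1+N)) (λ i 1≤i i≤N → others i 1≤i (ℕₚ.m≤n⇒m≤1+n i≤N)))
            (others (suc N) (s≤s z≤n) ℕₚ.≤-refl (k≢1+N ∘ ≡.sym)))
    (+-identityʳ _)

  Σ₁-telescope : ∀ N (F : ℕ → Carrier) → Σ₁ N (λ i → F (suc i) - F i) ≈ F (suc N) - F 1
  Σ₁-telescope zero    F = sym (-‿inverseʳ _)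
  Σ₁-telescope (suc N) F = begin
    Σ₁ N (λ i → F (suc i) - F i) + (F (suc (suc N)) - F (suc N))
      ≈⟨ +-congʳ (Σ₁-telescope N F) ⟩
    (F (suc N) - F 1) + (F (suc (suc N)) - F (suc N))
      ≈⟨ solve 3 (λ a b c → (a :- b) :+ (c :- a) := c :- b) refl (F (suc N)) (F 1) (F (suc (suc N))) ⟩
    F (suc (suc N)) - F 1 ∎

  when : ∀ {a} {A : Set a} → Dec A → Carrier → Carrier
  when a? x = if does a? then x else 0#

  private variable
    α β : Level
    A : Set α
    B : Set β

  when-yes : (a? : Dec A) {x : Carrier} → A → when a? x ≈ x
  when-yes a? {x} a rewrite dec-true a? a = refl

  when-no : (a? : Dec A) {x : Carrier} → ¬ A → when a? x ≈ 0#
  when-no a? ¬a rewrite dec-false a? ¬a = refl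

  when-cong : (a? : Dec A) {x y : Carrier} → (A → x ≈ y) → when a? x ≈ when a? y
  when-cong (yes a) x≈y = x≈y a
  when-cong (no _)  _   = refl

  when-⇔ : (a? : Dec A) (b? : Dec B) {x y : Carrier} → (A → B) → (B → A) → (A → x ≈ y) → when a? x ≈ when b? y
  when-⇔ (yes a) b? A⇒B _   x≈y = trans (x≈y a) (sym (when-yes b? (A⇒B a)))
  when-⇔ (no ¬a) b? _   B⇒A _   = sym (when-no b? (¬a ∘ B⇒A))

  when-*ˡ : (a? : Dec A) → ∀ x y → x * when a? y ≈ when a? (x * y)
  when-*ˡ (yes _) x y = refl
  when-*ˡ (no _)  x y = zeroʳ x

  when-+ : (a? : Dec A) → ∀ x y → when a? (x + y) ≈ when a? x + when a? y
  when-+ (yes _) x y = refl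
  when-+ (no _)  x y = sym (+-identityʳ _)

  when-neg : (a? : Dec A) → ∀ x → when a? (- x) ≈ - when a? x
  when-neg (yes _) x = refl
  when-neg (no _)  x = sym -0#≈0#

  when-Σ₁ : (a? : Dec A) → ∀ N F → when a? (Σ₁ N F) ≈ Σ₁ N (λ i → when a? (F i))
  when-Σ₁ (yes _) N F = refl
  when-Σ₁ (no _)  N F = sym (Σ₁-zero N (λ _ _ _ → refl))

  when-comm : (a? : Dec A) (b? : Dec B) → ∀ x → when a? (when b? x) ≈ when b? (when a? x)
  when-comm (yes _) b?      x = refl
  when-comm (no _)  (yes _) x = refl
  when-comm (no _)  (no _)  x = refl

  when-0# : (a? : Dec A) → when a? 0# ≈ 0#
  when-0# (yes _) = refl
  when-0# (no _)  = refl

  Σ₁-collapse : ∀ N u (G : ℕ → Carrier) → (u ≡ 0 → G u ≈ 0#) → (N < u → G u ≈ 0#) → Σ₁ N (λ x → when (u ℕ.≟ x) (G x)) ≈ G u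
  Σ₁-collapse N zero    G G0≈0 _ = trans (Σ₁-zero N (λ x 1≤x _ → when-no (0 ℕ.≟ x) (ℕₚ.<⇒≢ 1≤x))) (sym (G0≈0 ≡.refl))
  Σ₁-collapse N (suc u) G _ Gbig≈0 with suc u ≤? N
  ... | yes u<N = trans (Σ₁-single N (suc u) (s≤s z≤n) u<N (λ i _ _ i≢u → when-no (suc u ℕ.≟ i) (i≢u ∘ ≡.sym)))
                        (when-yes (suc u ℕ.≟ suc u) ≡.refl)
  ... | no u≮N  = trans (Σ₁-zero N (λ x _ x≤N → when-no (suc u ℕ.≟ x) (λ u≡x → u≮N (≡.subst (_≤ N) (≡.sym u≡x) x≤N))))
                        (sym (Gbig≈0 (ℕₚ.≰⇒> u≮N)))

  positive-factors : ∀ {d e n} → 1 ≤ n → d ℕ.* e ≡ n → 1 ≤ d × 1 ≤ e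
  positive-factors {zero}          1≤n ≡.refl = ⊥-elim (ℕₚ.1+n≰n 1≤n)
  positive-factors {suc d} {zero}  1≤n de≡n   = ⊥-elim (ℕₚ.<⇒≢ 1≤n (≡.trans (≡.sym (ℕₚ.*-zeroʳ d)) de≡n))
  positive-factors {suc d} {suc e} _   _      = s≤s z≤n , s≤s z≤n

  factorʳ-≤ : ∀ {d e n} → 1 ≤ d → d ℕ.* e ≡ n → e ≤ n
  factorʳ-≤ {suc d} {e} _ ≡.refl = ℕₚ.m≤m+n e (d ℕ.* e)

  factorˡ-≤ : ∀ {d e n} → 1 ≤ e → d ℕ.* e ≡ n → d ≤ n
  factorˡ-≤ {d} {e} 1≤e de≡n = factorʳ-≤ 1≤e (≡.trans (ℕₚ.*-comm e d) de≡n)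

  factorʳ-< : ∀ {d e n} → 2 ≤ d → 1 ≤ e → d ℕ.* e ≡ n → e < n
  factorʳ-< {suc zero}    (s≤s ()) _ _
  factorʳ-< {suc (suc d)} {e} _ 1≤e ≡.refl =
    ℕₚ.<-≤-trans (ℕₚ.m<m+n e 1≤e) (ℕₚ.+-monoʳ-≤ e (ℕₚ.m≤m+n e (d ℕ.* e)))

  pairSum : ℕ → ℕ → (ℕ → ℕ → Carrier) → Carrier
  pairSum N n F = Σ₁ N (λ d → Σ₁ N (λ e → when (d ℕ.* e ℕ.≟ n) (F d e)))

  pairSum-cong : ∀ N n {F G : ℕ → ℕ → Carrier} →
    (∀ d e → 1 ≤ d → d ≤ N → 1 ≤ e → e ≤ N → d ℕ.* e ≡ n → F d e ≈ G d e) → pairSum N n F ≈ pairSum N n G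
  pairSum-cong N n F≈G = Σ₁-cong-on N (λ d 1≤d d≤N → Σ₁-cong-on N (λ e 1≤e e≤N → when-cong (d ℕ.* e ℕ.≟ n)
      (F≈G d e 1≤d d≤N 1≤e e≤N)))

  pairSum-zero : ∀ N n {F : ℕ → ℕ → Carrier} →
    (∀ d e → 1 ≤ d → d ≤ N → 1 ≤ e → e ≤ N → d ℕ.* e ≡ n → F d e ≈ 0#) → pairSum N n F ≈ 0#
  pairSum-zero N n F≈0 = trans (pairSum-cong N n F≈0) (Σ₁-zero N (λ d _ _ → Σ₁-zero N (λ e _ _ → when-0# (d ℕ.* e ℕ.≟ n))))

  quotient-sum : ∀ N n k (F : ℕ → Carrier) → 1 ≤ n → n ≤ N →
    Σ₁ N (λ e → when (suc k ℕ.* e ℕ.≟ n) (F e)) ≈ when (suc k ∣? n) (F (n / suc k))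
  quotient-sum N n k F 1≤n n≤N = split (suc k ∣? n)
    where
    split : Dec (suc k ∣ n) → Σ₁ N (λ e → when (suc k ℕ.* e ℕ.≟ n) (F e)) ≈ when (suc k ∣? n) (F (n / suc k))
    split (no k∤n) = trans
      (Σ₁-zero N (λ e _ _ → when-no (suc k ℕ.* e ℕ.≟ n) (λ ke≡n → k∤n (divides e (≡.trans (≡.sym ke≡n)
          (ℕₚ.*-comm (suc k) e))))))
      (sym (when-no (suc k ∣? n) k∤n))
    split (yes k∣n) = begin
      Σ₁ N (λ e → when (suc k ℕ.* e ℕ.≟ n) (F e)) ≈⟨ Σ₁-single N q 1≤q (ℕₚ.≤-trans q≤n n≤N) others ⟩
      when (suc k ℕ.* q ℕ.≟ n) (F q)               ≈⟨ when-yes (suc k ℕ.* q ℕ.≟ n) (≡.sym n≡kq) ⟩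
      F q                                          ≡⟨ ≡.cong F (n/m≡quotient k∣n) ⟨
      F (n / suc k)                                ≈⟨ when-yes (suc k ∣? n) k∣n ⟨
      when (suc k ∣? n) (F (n / suc k))            ∎
      where
      q : ℕ
      q = quotient k∣n
      n≡kq : n ≡ suc k ℕ.* q
      n≡kq = m∣n⇒n≡m*quotient k∣n
      1≤q : 1 ≤ q
      1≤q = proj₂ (positive-factors {suc k} 1≤n (≡.sym n≡kq))
      q≤n : q ≤ n
      q≤n = factorʳ-≤ {suc k} (s≤s z≤n) (≡.sym n≡kq)
      others : ∀ e → 1 ≤ e → e ≤ N → e ≢ q → when (suc k ℕ.* e ℕ.≟ n) (F e) ≈ 0#
      others e _ _ e≢q = when-no (suc k ℕ.* e ℕ.≟ n) (λ ke≡n → e≢q (ℕₚ.*-cancelˡ-≡ e q (suc k) (≡.trans ke≡n n≡kq)))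

  divSum-pairSum : ∀ N n (F : ℕ → ℕ → Carrier) → 1 ≤ n → n ≤ N → divSum R n F ≈ pairSum N n F
  divSum-pairSum N n F 1≤n n≤N = begin
    divSum R n F
      ≈⟨ Σ₁-cong-on n (λ { (suc k) _ _ → sym (quotient-sum N n k (F (suc k)) 1≤n n≤N) }) ⟩
    Σ₁ n (λ d → Σ₁ N (λ e → when (d ℕ.* e ℕ.≟ n) (F d e)))
      ≈⟨ Σ₁-pad N n≤N (λ d n<d _ → Σ₁-zero N (λ e _ _ → when-no (d ℕ.* e ℕ.≟ n) (d*e≢n {d} {e} n<d))) ⟩
    pairSum N n F ∎
    where
    d*e≢n : ∀ {d e} → n < d → d ℕ.* e ≢ n
    d*e≢n {d} {e} n<d de≡n = ℕₚ.<⇒≱ n<d (factorˡ-≤ (proj₂ (positive-factors {d} 1≤n de≡n)) de≡n)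

  divSum-cong : ∀ n {F G : ℕ → ℕ → Carrier} → (∀ d e → F d e ≈ G d e) → divSum R n F ≈ divSum R n G
  divSum-cong n F≈G = Σ₁-cong n (λ { zero → refl ; (suc k) → when-cong (suc k ∣? n) (λ _ → F≈G (suc k) _) })

  divSum-+ : ∀ n (F G : ℕ → ℕ → Carrier) → divSum R n (λ d e → F d e + G d e) ≈ divSum R n F + divSum R n G
  divSum-+ n F G = trans (Σ₁-cong n (λ { zero → sym (+-identityʳ 0#) ; (suc k) → when-+ (suc k ∣? n) _ _ })) (Σ₁-+ n _ _)

  divSum-neg : ∀ n (F : ℕ → ℕ → Carrier) → divSum R n (λ d e → - F d e) ≈ - divSum R n F
  divSum-neg n F = trans (Σ₁-cong n (λ { zero → sym -0#≈0# ; (suc k) → when-neg (suc k ∣? n) _ })) (sym (Σ₁-neg n _))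

  divSum-*ˡ : ∀ n x (F : ℕ → ℕ → Carrier) → divSum R n (λ d e → x * F d e) ≈ x * divSum R n F
  divSum-*ˡ n x F = trans (Σ₁-cong n (λ { zero → sym (zeroʳ x) ; (suc k) → sym (when-*ˡ (suc k ∣? n) x _) }))
      (sym (Σ₁-*ˡ n x _))

  divSum-Σ₁ : ∀ n K (F : ℕ → ℕ → ℕ → Carrier) → divSum R n (λ d e → Σ₁ K (λ k → F k d e)) ≈ Σ₁ K (λ k → divSum R n (F k))
  divSum-Σ₁ n K F = trans (Σ₁-cong n (λ { zero → sym (Σ₁-zero K (λ _ _ _ → refl)) ; (suc k) →
      when-Σ₁ (suc k ∣? n) K _ })) (Σ₁-swap n K _)

  infixl 7 _⋆_
  infixl 6 _⊕_ _⊖_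

  _⋆_ : (ℕ → Carrier) → (ℕ → Carrier) → ℕ → Carrier
  _⋆_ = Defs._⋆_ R

  _⊕_ _⊖_ : (ℕ → Carrier) → (ℕ → Carrier) → ℕ → Carrier
  (a ⊕ b) n = a n + b n
  (a ⊖ b) n = a n - b n

  δ : ℕ → Carrier
  δ n = if does (n ℕ.≟ 1) then 1# else 0#

  ⋆-pairSum : ∀ a b n → 1 ≤ n → (a ⋆ b) n ≈ pairSum n n (λ d e → a d * b e)
  ⋆-pairSum a b n 1≤n = divSum-pairSum n n _ 1≤n ℕₚ.≤-refl

  ⋆-cong-on : ∀ {a a′ b b′} n → 1 ≤ n → (∀ d → 1 ≤ d → d ≤ n → a d ≈ a′ d) → (∀ e → 1 ≤ e → e ≤ n → b e ≈ b′ e) →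
    (a ⋆ b) n ≈ (a′ ⋆ b′) n
  ⋆-cong-on {a} {a′} {b} {b′} n 1≤n a≈a′ b≈b′ = begin
    (a ⋆ b) n
      ≈⟨ ⋆-pairSum a b n 1≤n ⟩
    pairSum n n (λ d e → a d * b e)
      ≈⟨ pairSum-cong n n (λ d e 1≤d d≤n 1≤e e≤n _ → *-cong (a≈a′ d 1≤d d≤n) (b≈b′ e 1≤e e≤n)) ⟩
    pairSum n n (λ d e → a′ d * b′ e)
      ≈⟨ ⋆-pairSum a′ b′ n 1≤n ⟨
    (a′ ⋆ b′) n ∎

  ⋆-comm : ∀ a b n → 1 ≤ n → (a ⋆ b) n ≈ (b ⋆ a) n
  ⋆-comm a b n 1≤n = begin
    (a ⋆ b) n
      ≈⟨ ⋆-pairSum a b n 1≤n ⟩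
    pairSum n n (λ d e → a d * b e)
      ≈⟨ Σ₁-swap n n _ ⟩
    Σ₁ n (λ e → Σ₁ n (λ d → when (d ℕ.* e ℕ.≟ n) (a d * b e)))
      ≈⟨ Σ₁-cong n (λ e → Σ₁-cong n (λ d → when-⇔ (d ℕ.* e ℕ.≟ n) (e ℕ.* d ℕ.≟ n)
         (≡.trans (ℕₚ.*-comm e d)) (≡.trans (ℕₚ.*-comm d e)) (λ _ → *-comm _ _))) ⟩
    pairSum n n (λ d e → b d * a e)
      ≈⟨ ⋆-pairSum b a n 1≤n ⟨
    (b ⋆ a) n ∎

  ⋆-distribʳ : ∀ a b c n → ((a ⊕ b) ⋆ c) n ≈ (a ⋆ c) n + (b ⋆ c) n
  ⋆-distribʳ a b c n = trans (divSum-cong n (λ _ _ → distribʳ _ _ _)) (divSum-+ n _ _)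

  ⋆-distribˡ : ∀ a b c n → (c ⋆ (a ⊕ b)) n ≈ (c ⋆ a) n + (c ⋆ b) n
  ⋆-distribˡ a b c n = trans (divSum-cong n (λ _ _ → distribˡ _ _ _)) (divSum-+ n _ _)

  ⋆-⊖ʳ : ∀ a b c n → (c ⋆ (a ⊖ b)) n ≈ (c ⋆ a) n - (c ⋆ b) n
  ⋆-⊖ʳ a b c n = begin
    (c ⋆ (a ⊖ b)) n                                          ≈⟨ divSum-cong n (λ _ _ → distribˡ _ _ _) ⟩
    divSum R n (λ d e → c d * a e + c d * - b e)             ≈⟨ divSum-+ n _ _ ⟩
    (c ⋆ a) n + divSum R n (λ d e → c d * - b e)             ≈⟨ +-congˡ (divSum-cong n (λ _ _ → sym (-‿distribʳ-* _ _))) ⟩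
    (c ⋆ a) n + divSum R n (λ d e → - (c d * b e))           ≈⟨ +-congˡ (divSum-neg n _) ⟩
    (c ⋆ a) n - (c ⋆ b) n                                    ∎

  ⋆-Σ₁ˡ : ∀ K (x : ℕ → Carrier) (a : ℕ → ℕ → Carrier) b n →
    ((λ m → Σ₁ K (λ k → x k * a k m)) ⋆ b) n ≈ Σ₁ K (λ k → x k * (a k ⋆ b) n)
  ⋆-Σ₁ˡ K x a b n = begin
    divSum R n (λ d e → Σ₁ K (λ k → x k * a k d) * b e)
      ≈⟨ divSum-cong n (λ _ _ → trans (Σ₁-*ʳ K _ _) (Σ₁-cong K (λ _ → *-assoc _ _ _))) ⟩
    divSum R n (λ d e → Σ₁ K (λ k → x k * (a k d * b e)))
      ≈⟨ divSum-Σ₁ n K _ ⟩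
    Σ₁ K (λ k → divSum R n (λ d e → x k * (a k d * b e)))
      ≈⟨ Σ₁-cong K (λ k → divSum-*ˡ n (x k) _) ⟩
    Σ₁ K (λ k → x k * (a k ⋆ b) n) ∎

  ⋆-Σ₁ʳ : ∀ K (a : ℕ → ℕ → Carrier) b n → (b ⋆ (λ m → Σ₁ K (λ k → a k m))) n ≈ Σ₁ K (λ k → (b ⋆ a k) n)
  ⋆-Σ₁ʳ K a b n = trans (divSum-cong n (λ _ _ → Σ₁-*ˡ K _ _)) (divSum-Σ₁ n K _)

  ⋆-identityˡ : ∀ a n → 1 ≤ n → (δ ⋆ a) n ≈ a n
  ⋆-identityˡ a n 1≤n = begin
    (δ ⋆ a) n                        ≈⟨ Σ₁-single n 1 (s≤s z≤n) 1≤n (λ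
                                          { (suc zero)    _ _ 1≢1 → ⊥-elim (1≢1 ≡.refl)
                                          ; (suc (suc k)) _ _ _   → trans (when-cong (suc (suc k) ∣? n) (λ _ → zeroˡ _))
                                              (when-0# (suc (suc k) ∣? n))
                                          }) ⟩
    when (1 ∣? n) (1# * a (n / 1))   ≈⟨ when-yes (1 ∣? n) (1∣ n) ⟩
    1# * a (n / 1)                   ≈⟨ *-identityˡ _ ⟩
    a (n / 1)                        ≡⟨ ≡.cong a (n/1≡n n) ⟩
    a n                              ∎

  ⋆-identityʳ : ∀ a n → 1 ≤ n → (a ⋆ δ) n ≈ a n
  ⋆-identityʳ a n 1≤n = trans (⋆-comm a δ n 1≤n) (⋆-identityˡ a n 1≤n)

  when-*-pairSum : (p? : Dec A) → ∀ x N m (Y : ℕ → ℕ → Carrier) →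
    when p? (x * pairSum N m Y) ≈ Σ₁ N (λ i → Σ₁ N (λ j → when p? (when (i ℕ.* j ℕ.≟ m) (x * Y i j))))
  when-*-pairSum p? x N m Y = begin
    when p? (x * pairSum N m Y)
      ≈⟨ when-cong p? (λ _ → Σ₁-*ˡ N x _) ⟩
    when p? (Σ₁ N (λ i → x * Σ₁ N (λ j → when (i ℕ.* j ℕ.≟ m) (Y i j))))
      ≈⟨ when-Σ₁ p? N _ ⟩
    Σ₁ N (λ i → when p? (x * Σ₁ N (λ j → when (i ℕ.* j ℕ.≟ m) (Y i j))))
      ≈⟨ Σ₁-cong N (λ i → when-cong p? (λ _ → Σ₁-*ˡ N x _)) ⟩
    Σ₁ N (λ i → when p? (Σ₁ N (λ j → x * when (i ℕ.* j ℕ.≟ m) (Y i j))))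
      ≈⟨ Σ₁-cong N (λ i → when-Σ₁ p? N _) ⟩
    Σ₁ N (λ i → Σ₁ N (λ j → when p? (x * when (i ℕ.* j ℕ.≟ m) (Y i j))))
      ≈⟨ Σ₁-cong N (λ i → Σ₁-cong N (λ j → when-cong p? (λ _ → when-*ˡ (i ℕ.* j ℕ.≟ m) x _))) ⟩
    Σ₁ N (λ i → Σ₁ N (λ j → when p? (when (i ℕ.* j ℕ.≟ m) (x * Y i j)))) ∎

  tripleSum : ℕ → (ℕ → ℕ → ℕ → Carrier) → Carrier
  tripleSum n T = Σ₁ n (λ d → Σ₁ n (λ d′ → Σ₁ n (λ e → when (d ℕ.* d′ ℕ.* e ℕ.≟ n) (T d d′ e))))

  ⋆ˡ-tripleSum : ∀ a b c n → 1 ≤ n → ((a ⋆ b) ⋆ c) n ≈ tripleSum n (λ d d′ e → (a d * b d′) * c e)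
  ⋆ˡ-tripleSum a b c n 1≤n = begin
    ((a ⋆ b) ⋆ c) n
      ≈⟨ ⋆-pairSum (a ⋆ b) c n 1≤n ⟩
    pairSum n n (λ x e → (a ⋆ b) x * c e)
      ≈⟨ pairSum-cong n n (λ x _ 1≤x x≤n _ _ _ → *-congʳ (divSum-pairSum n x _ 1≤x x≤n)) ⟩
    pairSum n n (λ x e → pairSum n x (λ d d′ → a d * b d′) * c e)
      ≈⟨ Σ₁-cong n (λ x → Σ₁-cong n (λ e → when-pairSum-* (x ℕ.* e ℕ.≟ n) (c e) x)) ⟩
    Σ₁ n (λ x → Σ₁ n (λ e → Σ₁ n (λ d → Σ₁ n (λ d′ → T x e d d′))))
      ≈⟨ reorder ⟩
    Σ₁ n (λ d → Σ₁ n (λ d′ → Σ₁ n (λ e → Σ₁ n (λ x → T x e d d′))))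
      ≈⟨ Σ₁-cong n (λ d → Σ₁-cong n (λ d′ → Σ₁-cong-on n (λ e 1≤e _ → collapse d d′ e 1≤e))) ⟩
    tripleSum n (λ d d′ e → (a d * b d′) * c e) ∎
    where
    T : ℕ → ℕ → ℕ → ℕ → Carrier
    T x e d d′ = when (x ℕ.* e ℕ.≟ n) (when (d ℕ.* d′ ℕ.≟ x) ((a d * b d′) * c e))

    when-pairSum-* : ∀ {P : Set} (p? : Dec P) y x →
      when p? (pairSum n x (λ d d′ → a d * b d′) * y)
        ≈ Σ₁ n (λ d → Σ₁ n (λ d′ → when p? (when (d ℕ.* d′ ℕ.≟ x) ((a d * b d′) * y))))
    when-pairSum-* p? y x = trans (when-cong p? (λ _ → *-comm _ _)) (trans (when-*-pairSum p? y n x _)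
      (Σ₁-cong n (λ d → Σ₁-cong n (λ d′ → when-cong p? (λ _ → when-cong (d ℕ.* d′ ℕ.≟ x) (λ _ → *-comm _ _))))))

    reorder : Σ₁ n (λ x → Σ₁ n (λ e → Σ₁ n (λ d → Σ₁ n (λ d′ → T x e d d′))))
            ≈ Σ₁ n (λ d → Σ₁ n (λ d′ → Σ₁ n (λ e → Σ₁ n (λ x → T x e d d′))))
    reorder = begin
      Σ₁ n (λ x → Σ₁ n (λ e → Σ₁ n (λ d → Σ₁ n (λ d′ → T x e d d′))))
        ≈⟨ Σ₁-cong n (λ x → trans (Σ₁-swap n n _) (Σ₁-cong n (λ d → Σ₁-swap n n _))) ⟩
      Σ₁ n (λ x → Σ₁ n (λ d → Σ₁ n (λ d′ → Σ₁ n (λ e → T x e d d′))))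
        ≈⟨ Σ₁-swap n n _ ⟩
      Σ₁ n (λ d → Σ₁ n (λ x → Σ₁ n (λ d′ → Σ₁ n (λ e → T x e d d′))))
        ≈⟨ Σ₁-cong n (λ d → trans (Σ₁-swap n n _) (Σ₁-cong n (λ d′ → Σ₁-swap n n _))) ⟩
      Σ₁ n (λ d → Σ₁ n (λ d′ → Σ₁ n (λ e → Σ₁ n (λ x → T x e d d′)))) ∎

    collapse : ∀ d d′ e → 1 ≤ e → Σ₁ n (λ x → T x e d d′) ≈ when (d ℕ.* d′ ℕ.* e ℕ.≟ n) ((a d * b d′) * c e)
    collapse d d′ e 1≤e = trans (Σ₁-cong n (λ x → when-comm (x ℕ.* e ℕ.≟ n) (d ℕ.* d′ ℕ.≟ x) _))
      (Σ₁-collapse n (d ℕ.* d′) (λ x → when (x ℕ.* e ℕ.≟ n) ((a d * b d′) * c e))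
        (λ dd′≡0 → when-no (d ℕ.* d′ ℕ.* e ℕ.≟ n) (λ dd′e≡n →
          ℕₚ.<⇒≢ (proj₁ (positive-factors {d ℕ.* d′} 1≤n dd′e≡n)) (≡.sym dd′≡0)))
        (λ n<dd′ → when-no (d ℕ.* d′ ℕ.* e ℕ.≟ n) (λ dd′e≡n → ℕₚ.<⇒≱ n<dd′ (factorˡ-≤ {d ℕ.* d′} 1≤e dd′e≡n))))

  ⋆ʳ-tripleSum : ∀ a b c n → 1 ≤ n → (a ⋆ (b ⋆ c)) n ≈ tripleSum n (λ d d′ e → a d * (b d′ * c e))
  ⋆ʳ-tripleSum a b c n 1≤n = begin
    (a ⋆ (b ⋆ c)) n
      ≈⟨ ⋆-pairSum a (b ⋆ c) n 1≤n ⟩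
    pairSum n n (λ d x → a d * (b ⋆ c) x)
      ≈⟨ pairSum-cong n n (λ _ x _ _ 1≤x x≤n _ → *-congˡ (divSum-pairSum n x _ 1≤x x≤n)) ⟩
    pairSum n n (λ d x → a d * pairSum n x (λ d′ e → b d′ * c e))
      ≈⟨ Σ₁-cong n (λ d → Σ₁-cong n (λ x → when-*-pairSum (d ℕ.* x ℕ.≟ n) (a d) n x _)) ⟩
    Σ₁ n (λ d → Σ₁ n (λ x → Σ₁ n (λ d′ → Σ₁ n (λ e → T d x d′ e))))
      ≈⟨ Σ₁-cong n (λ d → trans (Σ₁-swap n n _) (Σ₁-cong n (λ d′ → Σ₁-swap n n _))) ⟩
    Σ₁ n (λ d → Σ₁ n (λ d′ → Σ₁ n (λ e → Σ₁ n (λ x → T d x d′ e))))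
      ≈⟨ Σ₁-cong-on n (λ d 1≤d _ → Σ₁-cong n (λ d′ → Σ₁-cong n (λ e → collapse d d′ e 1≤d))) ⟩
    tripleSum n (λ d d′ e → a d * (b d′ * c e)) ∎
    where
    T : ℕ → ℕ → ℕ → ℕ → Carrier
    T d x d′ e = when (d ℕ.* x ℕ.≟ n) (when (d′ ℕ.* e ℕ.≟ x) (a d * (b d′ * c e)))

    collapse : ∀ d d′ e → 1 ≤ d → Σ₁ n (λ x → T d x d′ e) ≈ when (d ℕ.* d′ ℕ.* e ℕ.≟ n) (a d * (b d′ * c e))
    collapse d d′ e 1≤d = begin
      Σ₁ n (λ x → T d x d′ e)
        ≈⟨ Σ₁-cong n (λ x → when-comm (d ℕ.* x ℕ.≟ n) (d′ ℕ.* e ℕ.≟ x) _) ⟩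
      Σ₁ n (λ x → when (d′ ℕ.* e ℕ.≟ x) (when (d ℕ.* x ℕ.≟ n) _))
        ≈⟨ Σ₁-collapse n (d′ ℕ.* e) (λ x → when (d ℕ.* x ℕ.≟ n) (a d * (b d′ * c e)))
           (λ d′e≡0 → when-no (d ℕ.* (d′ ℕ.* e) ℕ.≟ n) (λ dd′e≡n →
             ℕₚ.<⇒≢ (proj₂ (positive-factors {d} 1≤n dd′e≡n)) (≡.sym d′e≡0)))
           (λ n<d′e → when-no (d ℕ.* (d′ ℕ.* e) ℕ.≟ n) (λ dd′e≡n → ℕₚ.<⇒≱ n<d′e (factorʳ-≤ {d} 1≤d dd′e≡n))) ⟩
      when (d ℕ.* (d′ ℕ.* e) ℕ.≟ n) (a d * (b d′ * c e))
        ≈⟨ when-⇔ (d ℕ.* (d′ ℕ.* e) ℕ.≟ n) (d ℕ.* d′ ℕ.* e ℕ.≟ n)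
           (≡.trans (ℕₚ.*-assoc d d′ e)) (≡.trans (≡.sym (ℕₚ.*-assoc d d′ e))) (λ _ → refl) ⟩
      when (d ℕ.* d′ ℕ.* e ℕ.≟ n) (a d * (b d′ * c e)) ∎

  ⋆-assoc : ∀ a b c n → 1 ≤ n → ((a ⋆ b) ⋆ c) n ≈ (a ⋆ (b ⋆ c)) n
  ⋆-assoc a b c n 1≤n = begin
    ((a ⋆ b) ⋆ c) n
      ≈⟨ ⋆ˡ-tripleSum a b c n 1≤n ⟩
    tripleSum n (λ d d′ e → (a d * b d′) * c e)
      ≈⟨ Σ₁-cong n (λ d → Σ₁-cong n (λ d′ → Σ₁-cong n (λ e → when-cong (d ℕ.* d′ ℕ.* e ℕ.≟ n) (λ _ → *-assoc _ _ _)))) ⟩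
    tripleSum n (λ d d′ e → a d * (b d′ * c e))
      ≈⟨ ⋆ʳ-tripleSum a b c n 1≤n ⟨
    (a ⋆ (b ⋆ c)) n ∎

  _^⋆_ : (ℕ → Carrier) → ℕ → ℕ → Carrier
  a ^⋆ zero  = δ
  a ^⋆ suc k = a ⋆ (a ^⋆ k)

  ^⋆-vanishes : ∀ a → a 1 ≈ 0# → ∀ k n → 1 ≤ n → n ≤ k → (a ^⋆ k) n ≈ 0#
  ^⋆-vanishes a a1≈0 zero    n 1≤n n≤0 = ⊥-elim (ℕₚ.1+n≰n (ℕₚ.≤-trans 1≤n n≤0))
  ^⋆-vanishes a a1≈0 (suc k) n 1≤n n≤k = trans (⋆-pairSum a (a ^⋆ k) n 1≤n) (pairSum-zero n n term≈0)
    where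
    term≈0 : ∀ d e → 1 ≤ d → d ≤ n → 1 ≤ e → e ≤ n → d ℕ.* e ≡ n → a d * (a ^⋆ k) e ≈ 0#
    term≈0 (suc zero)    e _   _ _   _ _  = trans (*-congʳ a1≈0) (zeroˡ _)
    term≈0 (suc (suc d)) e _ _ 1≤e _ de≡n =
      trans (*-congˡ (^⋆-vanishes a a1≈0 k e 1≤e e≤k)) (zeroʳ _)
      where
      e≤k : e ≤ k
      e≤k = ℕₚ.≤-pred (ℕₚ.≤-trans (factorʳ-< {suc (suc d)} (s≤s (s≤s z≤n)) 1≤e de≡n) n≤k)

  module InverseOf (f : ℕ → Carrier) (f1≈1 : f 1 ≈ 1#) where

    f₊ : ℕ → Carrier
    f₊ n = if does (n ℕ.≟ 1) then 0# else f n

    ⋆-split : ∀ X n → 1 ≤ n → (f ⋆ X) n ≈ X n + (f₊ ⋆ X) n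
    ⋆-split X n 1≤n = begin
      (f ⋆ X) n              ≈⟨ ⋆-cong-on n 1≤n f≈f₊⊕δ (λ _ _ _ → refl) ⟩
      ((f₊ ⊕ δ) ⋆ X) n       ≈⟨ ⋆-distribʳ f₊ δ X n ⟩
      (f₊ ⋆ X) n + (δ ⋆ X) n ≈⟨ +-comm _ _ ⟩
      (δ ⋆ X) n + (f₊ ⋆ X) n ≈⟨ +-congʳ (⋆-identityˡ X n 1≤n) ⟩
      X n + (f₊ ⋆ X) n       ∎
      where
      f≈f₊⊕δ : ∀ d → 1 ≤ d → d ≤ n → f d ≈ (f₊ ⊕ δ) d
      f≈f₊⊕δ (suc zero)    _ _ = trans f1≈1 (sym (+-identityˡ _))
      f≈f₊⊕δ (suc (suc _)) _ _ = sym (+-identityʳ _)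

    ds-suc : ∀ j n → ds R (suc (suc j)) f n ≈ (f₊ ⋆ ds R (suc j) f) n
    ds-suc j n = Σ₁-cong n λ
      { zero          → refl
      ; (suc zero)    → sym (trans (when-cong (1 ∣? n) (λ _ → zeroˡ _)) (when-0# (1 ∣? n)))
      ; (suc (suc k)) → refl
      }

    ds≈^⋆-difference : ∀ j n → 1 ≤ n → ds R (suc j) f n ≈ (f₊ ^⋆ suc j) n - (f₊ ^⋆ j) n
    ds≈^⋆-difference zero (suc zero) 1≤n = begin
      - 1#                 ≈⟨ +-identityˡ _ ⟨
      0# - 1#              ≈⟨ +-congʳ (⋆-identityʳ f₊ 1 1≤n) ⟨
      (f₊ ^⋆ 1) 1 - 1#     ∎
    ds≈^⋆-difference zero (suc (suc k)) 1≤n = begin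
      f (suc (suc k))                  ≈⟨ +-identityʳ _ ⟨
      f (suc (suc k)) + 0#             ≈⟨ +-cong (⋆-identityʳ f₊ (suc (suc k)) 1≤n) -0#≈0# ⟨
      (f₊ ^⋆ 1) (suc (suc k)) - 0#     ∎
    ds≈^⋆-difference (suc j) n 1≤n = begin
      ds R (suc (suc j)) f n
        ≈⟨ ds-suc j n ⟩
      (f₊ ⋆ ds R (suc j) f) n
        ≈⟨ ⋆-cong-on n 1≤n (λ _ _ _ → refl) (λ e 1≤e _ → ds≈^⋆-difference j e 1≤e) ⟩
      (f₊ ⋆ ((f₊ ^⋆ suc j) ⊖ (f₊ ^⋆ j))) n
        ≈⟨ ⋆-⊖ʳ _ _ f₊ n ⟩
      (f₊ ^⋆ suc (suc j)) n - (f₊ ^⋆ suc j) n ∎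

    f₊^⋆-vanishes : ∀ k n → 1 ≤ n → n ≤ k → (f₊ ^⋆ k) n ≈ 0#
    f₊^⋆-vanishes = ^⋆-vanishes f₊ refl

    ds-vanishes : ∀ t m → 1 ≤ m → m ≤ t → ds R (suc t) f m ≈ 0#
    ds-vanishes t m 1≤m m≤t = begin
      ds R (suc t) f m
        ≈⟨ ds≈^⋆-difference t m 1≤m ⟩
      (f₊ ^⋆ suc t) m - (f₊ ^⋆ t) m
        ≈⟨ +-cong (f₊^⋆-vanishes (suc t) m 1≤m (ℕₚ.m≤n⇒m≤1+n m≤t)) (-‿cong (f₊^⋆-vanishes t m 1≤m m≤t)) ⟩
      0# - 0#
        ≈⟨ -‿inverseʳ 0# ⟩
      0# ∎

    D-pad : ∀ N m → 1 ≤ m → m ≤ N → D R f m ≈ Σ₁ N (λ j → ds R (2 ℕ.* j) f m)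
    D-pad N m 1≤m m≤N = Σ₁-pad N m≤N λ
      { (suc j) m<1+j _ → ds-vanishes (j ℕ.+ suc (j ℕ.+ 0)) m 1≤m (ℕₚ.≤-trans (ℕₚ.≤-pred m<1+j) (ℕₚ.m≤m+n j _)) }

    odd-power : ℕ → ℕ → Carrier
    odd-power i = f₊ ^⋆ (2 ℕ.* i ∸ 1)

    f⋆ds-even : ∀ j n → 1 ≤ n → (f ⋆ ds R (2 ℕ.* suc j) f) n ≈ odd-power (suc (suc j)) n - odd-power (suc j) n
    f⋆ds-even j n 1≤n = begin
      (f ⋆ ds R (suc t) f) n
        ≈⟨ ⋆-split _ n 1≤n ⟩
      ds R (suc t) f n + (f₊ ⋆ ds R (suc t) f) n
        ≈⟨ +-congˡ (ds-suc t n) ⟨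
      ds R (suc t) f n + ds R (suc (suc t)) f n
        ≈⟨ +-cong (ds≈^⋆-difference t n 1≤n) (ds≈^⋆-difference (suc t) n 1≤n) ⟩
      ((f₊ ^⋆ suc t) n - (f₊ ^⋆ t) n) + ((f₊ ^⋆ suc (suc t)) n - (f₊ ^⋆ suc t) n)
        ≈⟨ solve 3 (λ a b c → (a :- b) :+ (c :- a) := c :- b) refl _ _ _ ⟩
      (f₊ ^⋆ suc (suc t)) n - (f₊ ^⋆ t) n
        ≡⟨ ≡.cong (λ k → (f₊ ^⋆ k) n - (f₊ ^⋆ t) n) (≡.cong suc (≡.sym (ℕₚ.+-suc j (suc (j ℕ.+ 0))))) ⟩
      odd-power (suc (suc j)) n - odd-power (suc j) n ∎
      where
      t : ℕ
      t = j ℕ.+ suc (j ℕ.+ 0)   -- 2 ℕ.* suc j reduces to suc t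

    ⋆-inverse : ∀ n → 1 ≤ n → (f ⋆ (δ ⊕ D R f)) n ≈ δ n
    ⋆-inverse n 1≤n = begin
      (f ⋆ (δ ⊕ D R f)) n                                   ≈⟨ ⋆-distribˡ δ (D R f) f n ⟩
      (f ⋆ δ) n + (f ⋆ D R f) n                             ≈⟨ +-cong (⋆-identityʳ f n 1≤n) f⋆D ⟩
      f n + (0# - f₊ n)                                     ≈⟨ f-f₊ n 1≤n ⟩
      δ n                                                   ∎
      where
      f-f₊ : ∀ n → 1 ≤ n → f n + (0# - f₊ n) ≈ δ n
      f-f₊ (suc zero)    _ = trans (+-cong f1≈1 (+-congˡ -0#≈0#)) (trans (+-congˡ (+-identityʳ 0#)) (+-identityʳ _))
      f-f₊ (suc (suc k)) _ = trans (+-congˡ (+-identityˡ _)) (-‿inverseʳ _)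

      f⋆D : (f ⋆ D R f) n ≈ 0# - f₊ n
      f⋆D = begin
        (f ⋆ D R f) n
          ≈⟨ ⋆-cong-on n 1≤n (λ _ _ _ → refl) (λ m 1≤m m≤n → D-pad n m 1≤m m≤n) ⟩
        (f ⋆ (λ m → Σ₁ n (λ j → ds R (2 ℕ.* j) f m))) n
          ≈⟨ ⋆-Σ₁ʳ n (λ j → ds R (2 ℕ.* j) f) f n ⟩
        Σ₁ n (λ j → (f ⋆ ds R (2 ℕ.* j) f) n)
          ≈⟨ Σ₁-cong-on n (λ { (suc j) _ _ → f⋆ds-even j n 1≤n }) ⟩
        Σ₁ n (λ j → odd-power (suc j) n - odd-power j n)
          ≈⟨ Σ₁-telescope n (λ i → odd-power i n) ⟩
        odd-power (suc n) n - odd-power 1 n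
          ≈⟨ +-cong (f₊^⋆-vanishes (2 ℕ.* suc n ∸ 1) n 1≤n (ℕₚ.m≤m+n n _)) (-‿cong (⋆-identityʳ f₊ n 1≤n)) ⟩
        0# - f₊ n ∎

  ⋆-solution : ∀ f g b → f 1 ≈ 1# → (∀ n → 1 ≤ n → (f ⋆ g) n ≈ b n) → ∀ n → 1 ≤ n → g n ≈ b n + (D R f ⋆ b) n
  ⋆-solution f g b f1≈1 f⋆g≈b n 1≤n = begin
    g n
      ≈⟨ ⋆-identityˡ g n 1≤n ⟨
    (δ ⋆ g) n
      ≈⟨ ⋆-cong-on n 1≤n (λ d 1≤d _ → trans (sym (⋆-inverse d 1≤d)) (⋆-comm f _ d 1≤d)) (λ _ _ _ → refl) ⟩
    (((δ ⊕ D R f) ⋆ f) ⋆ g) n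
      ≈⟨ ⋆-assoc (δ ⊕ D R f) f g n 1≤n ⟩
    ((δ ⊕ D R f) ⋆ (f ⋆ g)) n
      ≈⟨ ⋆-cong-on n 1≤n (λ _ _ _ → refl) (λ e 1≤e _ → f⋆g≈b e 1≤e) ⟩
    ((δ ⊕ D R f) ⋆ b) n
      ≈⟨ ⋆-distribʳ δ (D R f) b n ⟩
    (δ ⋆ b) n + (D R f ⋆ b) n
      ≈⟨ +-congʳ (⋆-identityˡ b n 1≤n) ⟩
    b n + (D R f ⋆ b) n ∎
    where open InverseOf f f1≈1

  Σ₀ : ℕ → (ℕ → Carrier) → Carrier
  Σ₀ zero    F = 0#
  Σ₀ (suc N) F = Σ₀ N F + F N

  Σ₀-cong-on : ∀ N {F G : ℕ → Carrier} → (∀ i → i < N → F i ≈ G i) → Σ₀ N F ≈ Σ₀ N G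
  Σ₀-cong-on zero    F≈G = refl
  Σ₀-cong-on (suc N) F≈G = +-cong (Σ₀-cong-on N (λ i i<N → F≈G i (ℕₚ.m≤n⇒m≤1+n i<N))) (F≈G N ℕₚ.≤-refl)

  Σ₀-cong : ∀ N {F G : ℕ → Carrier} → (∀ i → F i ≈ G i) → Σ₀ N F ≈ Σ₀ N G
  Σ₀-cong N F≈G = Σ₀-cong-on N (λ i _ → F≈G i)

  Σ₀-zero : ∀ N {F : ℕ → Carrier} → (∀ i → i < N → F i ≈ 0#) → Σ₀ N F ≈ 0#
  Σ₀-zero zero    F≈0 = refl
  Σ₀-zero (suc N) F≈0 = trans (+-cong (Σ₀-zero N (λ i i<N → F≈0 i (ℕₚ.m≤n⇒m≤1+n i<N))) (F≈0 N ℕₚ.≤-refl)) (+-identityʳ _)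

  Σ₀-+ : ∀ N (F G : ℕ → Carrier) → Σ₀ N (λ i → F i + G i) ≈ Σ₀ N F + Σ₀ N G
  Σ₀-+ zero    F G = sym (+-identityʳ _)
  Σ₀-+ (suc N) F G = trans (+-congʳ (Σ₀-+ N F G)) (interchange _ _ _ _)

  Σ₀-*ˡ : ∀ N x (F : ℕ → Carrier) → x * Σ₀ N F ≈ Σ₀ N (λ i → x * F i)
  Σ₀-*ˡ zero    x F = zeroʳ x
  Σ₀-*ˡ (suc N) x F = trans (distribˡ _ _ _) (+-congʳ (Σ₀-*ˡ N x F))

  Σ₀-Σ₁ : ∀ N M (F : ℕ → ℕ → Carrier) → Σ₀ N (λ i → Σ₁ M (F i)) ≈ Σ₁ M (λ j → Σ₀ N (λ i → F i j))
  Σ₀-Σ₁ zero    M F = sym (Σ₁-zero M (λ _ _ _ → refl))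
  Σ₀-Σ₁ (suc N) M F = trans (+-congʳ (Σ₀-Σ₁ N M F)) (sym (Σ₁-+ M _ _))

  Σ₀-shift : ∀ N (F : ℕ → Carrier) → Σ₀ (suc N) F ≈ F 0 + Σ₀ N (λ i → F (suc i))
  Σ₀-shift zero    F = trans (+-identityˡ _) (sym (+-identityʳ _))
  Σ₀-shift (suc N) F = trans (+-congʳ (Σ₀-shift N F)) (+-assoc _ _ _)

  Σ₀≈Σ₁ : ∀ N (F : ℕ → Carrier) → Σ₀ (suc N) F ≈ F 0 + Σ₁ N F
  Σ₀≈Σ₁ zero    F = trans (+-identityˡ _) (sym (+-identityʳ _))
  Σ₀≈Σ₁ (suc N) F = trans (+-congʳ (Σ₀≈Σ₁ N F)) (+-assoc _ _ _)

  Σ₀-reverse : ∀ m (F : ℕ → Carrier) → Σ₀ (suc m) (λ k → F (m ∸ k)) ≈ Σ₀ (suc m) F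
  Σ₀-reverse zero    F = refl
  Σ₀-reverse (suc m) F = begin
    Σ₀ (suc (suc m)) (λ k → F (suc m ∸ k)) ≈⟨ Σ₀-shift (suc m) _ ⟩
    F (suc m) + Σ₀ (suc m) (λ k → F (m ∸ k)) ≈⟨ +-congˡ (Σ₀-reverse m F) ⟩
    F (suc m) + Σ₀ (suc m) F                 ≈⟨ +-comm _ _ ⟩
    Σ₀ (suc (suc m)) F                       ∎

  Σ₀-pad : ∀ {N} M {F : ℕ → Carrier} → N ≤ M → (∀ i → N ≤ i → i < M → F i ≈ 0#) → Σ₀ N F ≈ Σ₀ M F
  Σ₀-pad zero z≤n _ = refl
  Σ₀-pad {N} (suc M) {F} N≤1+M zeros with ℕₚ.m≤n⇒m<n∨m≡n N≤1+M
  ... | inj₂ ≡.refl = refl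
  ... | inj₁ (s≤s N≤M) = begin
    Σ₀ N F         ≈⟨ Σ₀-pad M N≤M (λ i N≤i i<M → zeros i N≤i (ℕₚ.m≤n⇒m≤1+n i<M)) ⟩
    Σ₀ M F         ≈⟨ +-identityʳ _ ⟨
    Σ₀ M F + 0#    ≈⟨ +-congˡ (zeros M N≤M ℕₚ.≤-refl) ⟨
    Σ₀ (suc M) F   ∎

  Σ₀-single : ∀ N k {F : ℕ → Carrier} → k < N → (∀ i → i < N → i ≢ k → F i ≈ 0#) → Σ₀ N F ≈ F k
  Σ₀-single zero    k () _
  Σ₀-single (suc N) k {F} k<1+N others with k ℕ.≟ N
  ... | yes ≡.refl = trans (+-congʳ (Σ₀-zero N (λ i i<N → others i (ℕₚ.m≤n⇒m≤1+n i<N) (ℕₚ.<⇒≢ i<N)))) (+-identityˡ _)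
  ... | no k≢N = trans
    (+-cong (Σ₀-single N k (ℕₚ.≤∧≢⇒< (ℕₚ.≤-pred k<1+N) k≢N) (λ i i<N → others i (ℕₚ.m≤n⇒m≤1+n i<N)))
            (others N ℕₚ.≤-refl (k≢N ∘ ≡.sym)))
    (+-identityʳ _)

  Σ₀-telescope : ∀ N (w : ℕ → Carrier) → Σ₀ N (λ k → w k - w (suc k)) ≈ w 0 - w N
  Σ₀-telescope zero    w = sym (-‿inverseʳ _)
  Σ₀-telescope (suc N) w = begin
    Σ₀ N (λ k → w k - w (suc k)) + (w N - w (suc N))
      ≈⟨ +-congʳ (Σ₀-telescope N w) ⟩
    (w 0 - w N) + (w N - w (suc N))
      ≈⟨ solve 3 (λ a b c → (a :- b) :+ (b :- c) := a :- c) refl (w 0) (w N) (w (suc N)) ⟩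
    w 0 - w (suc N) ∎

  -- Power series are coefficient sequences: shift a multiplies by x^a, oneMinus i by 1 - x^i,
  -- and eulerFactors k d by the product of 1 - x^i over k < i ≤ k + d.
  Series : Set c
  Series = ℕ → Carrier

  infix 4 _≐_
  _≐_ : Series → Series → Set ℓ
  s ≐ t = ∀ m → s m ≈ t m

  shift : ℕ → Series → Series
  shift a s m = when (a ≤? m) (s (m ∸ a))

  shift-cong : ∀ a {s t} → s ≐ t → shift a s ≐ shift a t
  shift-cong a s≐t m = when-cong (a ≤? m) (λ _ → s≐t (m ∸ a))

  shift-congˡ : ∀ {a b} s m → a ≡ b → shift a s m ≈ shift b s m
  shift-congˡ s m ≡.refl = refl

  shift-vanishes : ∀ a s m → m < a → shift a s m ≈ 0#
  shift-vanishes a s m m<a = when-no (a ≤? m) (ℕₚ.<⇒≱ m<a)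

  shift-shift : ∀ a b s → shift a (shift b s) ≐ shift (a ℕ.+ b) s
  shift-shift a b s m = split (a ≤? m)
    where
    split : (a≤?m : Dec (a ≤ m)) → when a≤?m (shift b s (m ∸ a)) ≈ shift (a ℕ.+ b) s m
    split (no a≰m)  = sym (when-no (a ℕ.+ b ≤? m) (λ a+b≤m → a≰m (ℕₚ.≤-trans (ℕₚ.m≤m+n a b) a+b≤m)))
    split (yes a≤m) = when-⇔ (b ≤? m ∸ a) (a ℕ.+ b ≤? m) fwd bwd (λ _ → reflexive (≡.cong s (ℕₚ.∸-+-assoc m a b)))
      where
      fwd : b ≤ m ∸ a → a ℕ.+ b ≤ m
      fwd b≤m-a = ≡.subst (a ℕ.+ b ≤_) (ℕₚ.m+[n∸m]≡n a≤m) (ℕₚ.+-monoʳ-≤ a b≤m-a)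
      bwd : a ℕ.+ b ≤ m → b ≤ m ∸ a
      bwd a+b≤m = ≡.subst (_≤ m ∸ a) (ℕₚ.m+n∸m≡n a b) (ℕₚ.∸-monoˡ-≤ a a+b≤m)

  shift-comm : ∀ a b s → shift a (shift b s) ≐ shift b (shift a s)
  shift-comm a b s m = trans (shift-shift a b s m) (trans (shift-congˡ s m (ℕₚ.+-comm a b)) (sym (shift-shift b a s m)))

  oneMinus : ℕ → Series → Series
  oneMinus i s m = s m - shift i s m

  oneMinus-cong : ∀ i {s t} → s ≐ t → oneMinus i s ≐ oneMinus i t
  oneMinus-cong i s≐t m = +-cong (s≐t m) (-‿cong (shift-cong i s≐t m))

  shift-oneMinus : ∀ a i s m → shift a (oneMinus i s) m ≈ shift a s m - shift a (shift i s) m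
  shift-oneMinus a i s m = trans (when-+ (a ≤? m) _ _) (+-congˡ (when-neg (a ≤? m) _))

  oneMinus-comm : ∀ a b s → oneMinus a (oneMinus b s) ≐ oneMinus b (oneMinus a s)
  oneMinus-comm a b s m = begin
    (s m - shift b s m) - shift a (oneMinus b s) m
      ≈⟨ +-congˡ (-‿cong (shift-oneMinus a b s m)) ⟩
    (s m - shift b s m) - (shift a s m - shift a (shift b s) m)
      ≈⟨ +-congˡ (-‿cong (+-congˡ (-‿cong (shift-comm a b s m)))) ⟩
    (s m - shift b s m) - (shift a s m - shift b (shift a s) m)
      ≈⟨ solve 4 (λ x y z w → (x :- y) :- (z :- w) := (x :- z) :- (y :- w)) refl _ _ _ _ ⟩
    (s m - shift a s m) - (shift b s m - shift b (shift a s) m)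
      ≈⟨ +-congˡ (-‿cong (shift-oneMinus b a s m)) ⟨
    (s m - shift a s m) - shift b (oneMinus a s) m ∎

  eulerFactors : ℕ → ℕ → Series → Series
  eulerFactors k zero    s = s
  eulerFactors k (suc d) s = oneMinus (suc k) (eulerFactors (suc k) d s)

  eulerFactors-cong : ∀ k d {s t} → s ≐ t → eulerFactors k d s ≐ eulerFactors k d t
  eulerFactors-cong k zero    s≐t = s≐t
  eulerFactors-cong k (suc d) s≐t = oneMinus-cong (suc k) (eulerFactors-cong (suc k) d s≐t)

  eulerFactors-oneMinus : ∀ k d i s → eulerFactors k d (oneMinus i s) ≐ oneMinus i (eulerFactors k d s)
  eulerFactors-oneMinus k zero    i s m = refl
  eulerFactors-oneMinus k (suc d) i s m =
    trans (oneMinus-cong (suc k) (eulerFactors-oneMinus (suc k) d i s) m)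
        (oneMinus-comm (suc k) i (eulerFactors (suc k) d s) m)

  eulerFactors-suc : ∀ k d s → eulerFactors k (suc d) s ≐ oneMinus (suc (k ℕ.+ d)) (eulerFactors k d s)
  eulerFactors-suc k zero    s m = reflexive (≡.cong (λ i → oneMinus (suc i) s m) (≡.sym (ℕₚ.+-identityʳ k)))
  eulerFactors-suc k (suc d) s m = begin
    oneMinus (suc k) (eulerFactors (suc k) (suc d) s) m
      ≈⟨ oneMinus-cong (suc k) (eulerFactors-suc (suc k) d s) m ⟩
    oneMinus (suc k) (oneMinus (suc (suc k ℕ.+ d)) (eulerFactors (suc k) d s)) m
      ≈⟨ oneMinus-comm (suc k) (suc (suc k ℕ.+ d)) (eulerFactors (suc k) d s) m ⟩
    oneMinus (suc (suc k ℕ.+ d)) (eulerFactors k (suc d) s) m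
      ≡⟨ ≡.cong (λ i → oneMinus (suc i) (eulerFactors k (suc d) s) m) (≡.sym (ℕₚ.+-suc k d)) ⟩
    oneMinus (suc (k ℕ.+ suc d)) (eulerFactors k (suc d) s) m ∎

  sgn : ℕ → Carrier
  sgn = sgnPow R

  shanksSum : ℕ → Series → Series
  shanksSum n s m = Σ₀ (suc n) (λ k → sgn k * shift (shanksExponent n k) (eulerFactors k (n ∸ k) s) m)

  pentagonalSum : ℕ → Series → Series
  pentagonalSum N s m = s m + Σ₁ N (λ j → sgn j * (shift (pentagonal⁻ j) s m + shift (pentagonal⁺ j) s m))

  module ShanksStep (n : ℕ) (s : Series) (m : ℕ) where

    term term₊ w : ℕ → Carrier
    term  k = sgn k * shift (shanksExponent n k) (eulerFactors k (n ∸ k) s) m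
    term₊ k = sgn k * shift (shanksExponent (suc n) k) (eulerFactors k (suc n ∸ k) s) m
    w zero    = 0#
    w (suc j) = sgn (suc (suc j)) * shift (shanksExponent n (suc j)) (eulerFactors j (n ∸ j) s) m

    peel : ∀ k e → k ≤ n → shift e (eulerFactors k (suc n ∸ k) s) m ≈
      shift e (eulerFactors k (n ∸ k) s) m - shift (e ℕ.+ suc n) (eulerFactors k (n ∸ k) s) m
    peel k e k≤n = begin
      shift e (eulerFactors k (suc n ∸ k) s) m
        ≡⟨ ≡.cong (λ d → shift e (eulerFactors k d s) m) (ℕₚ.+-∸-assoc 1 k≤n) ⟩
      shift e (eulerFactors k (suc (n ∸ k)) s) m
        ≈⟨ shift-cong e (eulerFactors-suc k (n ∸ k) s) m ⟩
      shift e (oneMinus (suc (k ℕ.+ (n ∸ k))) P) m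
        ≡⟨ ≡.cong (λ i → shift e (oneMinus (suc i) P) m) (ℕₚ.m+[n∸m]≡n k≤n) ⟩
      shift e (oneMinus (suc n) P) m
        ≈⟨ shift-oneMinus e (suc n) P m ⟩
      shift e P m - shift e (shift (suc n) P) m
        ≈⟨ +-congˡ (-‿cong (shift-shift e (suc n) P m)) ⟩
      shift e P m - shift (e ℕ.+ suc n) P m ∎
      where
      P : Series
      P = eulerFactors k (n ∸ k) s

    -- Peeling the factor (1 - x^(n+1)) off term₊ k and splitting x^k = 1 - (1 - x^k) makes the
    -- difference term₊ k - term k telescope.
    term₊-telescopes : ∀ k → k ≤ n → term₊ k ≈ term k + (w k - w (suc k))
    term₊-telescopes zero 0≤n = begin
      1# * shift e₊ (eulerFactors 0 (suc n) s) m
        ≈⟨ *-congˡ (peel 0 e₊ 0≤n) ⟩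
      1# * (shift e₊ P m - shift (e₊ ℕ.+ suc n) P m)
        ≈⟨ *-congˡ (+-cong (shift-congˡ P m (exp0 n)) (-‿cong (shift-congˡ P m (exp1 n)))) ⟩
      1# * (shift e P m - shift e′ P m)
        ≈⟨ solve 3 (λ o x y → o :* (x :- y) := o :* x :+ (con (ℤ.+ 0) :- (:- (:- o)) :* y)) refl 1# _ _ ⟩
      1# * shift e P m + (0# - (- - 1#) * shift e′ P m) ∎
      where
      P : Series
      P = eulerFactors 0 n s
      e₊ e e′ : ℕ
      e₊ = shanksExponent (suc n) 0
      e  = shanksExponent n 0
      e′ = shanksExponent n 1
      exp0 : ∀ n → suc n ℕ.* 0 ℕ.+ 0 ≡ n ℕ.* 0 ℕ.+ 0
      exp0 = solve-∀
      exp1 : ∀ n → (suc n ℕ.* 0 ℕ.+ 0) ℕ.+ suc n ≡ n ℕ.* 1 ℕ.+ (0 ℕ.+ 1)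
      exp1 = solve-∀
    term₊-telescopes (suc j) k≤n = begin
      σ * shift e₊ (eulerFactors k (suc n ∸ k) s) m
        ≈⟨ *-congˡ (peel k e₊ k≤n) ⟩
      σ * (shift e₊ P m - shift (e₊ ℕ.+ suc n) P m)
        ≈⟨ *-congˡ (+-cong (shift-congˡ P m (exp-k n k (triangle k))) (-‿cong (shift-congˡ P m (exp-n n k (triangle k))))) ⟩
      σ * (shift (e ℕ.+ k) P m - shift e′ P m)
        ≈⟨ solve 4 (λ σ x x′ y → σ :* (x′ :- y) := σ :* x :+ ((:- σ) :* (x :- x′) :- (:- (:- σ)) :* y)) refl σ _ _ _ ⟩
      σ * shift e P m + ((- σ) * (shift e P m - shift (e ℕ.+ k) P m) - (- - σ) * shift e′ P m)
        ≈⟨ +-congˡ (+-congʳ (*-congˡ (sym one-minus-x^k))) ⟩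
      σ * shift e P m + ((- σ) * shift e (eulerFactors j (n ∸ j) s) m - (- - σ) * shift e′ P m) ∎
      where
      k : ℕ
      k = suc j
      σ : Carrier
      σ = sgn k
      P : Series
      P = eulerFactors k (n ∸ k) s
      e₊ e e′ : ℕ
      e₊ = shanksExponent (suc n) k
      e  = shanksExponent n k
      e′ = shanksExponent n (suc k)
      exp-k : ∀ n k t → suc n ℕ.* k ℕ.+ t ≡ (n ℕ.* k ℕ.+ t) ℕ.+ k
      exp-k = solve-∀
      exp-n : ∀ n k t → (suc n ℕ.* k ℕ.+ t) ℕ.+ suc n ≡ n ℕ.* suc k ℕ.+ (t ℕ.+ suc k)
      exp-n = solve-∀
      one-minus-x^k : shift e (eulerFactors j (n ∸ j) s) m ≈ shift e P m - shift (e ℕ.+ k) P m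
      one-minus-x^k = begin
        shift e (eulerFactors j (n ∸ j) s) m    ≡⟨ ≡.cong (λ d → shift e (eulerFactors j d s) m) (ℕₚ.+-∸-assoc 1 k≤n) ⟩
        shift e (oneMinus k P) m                 ≈⟨ shift-oneMinus e k P m ⟩
        shift e P m - shift e (shift k P) m      ≈⟨ +-congˡ (-‿cong (shift-shift e k P m)) ⟩
        shift e P m - shift (e ℕ.+ k) P m        ∎

  shanks : ∀ n s → shanksSum n s ≐ pentagonalSum n s
  shanks zero    s m = trans (+-identityˡ _) (trans (*-identityˡ _) (sym (+-identityʳ _)))
  shanks (suc n) s m = begin
    Σ₀ (suc n) term₊ + term₊ (suc n)
      ≈⟨ +-congʳ (Σ₀-cong-on (suc n) (λ k k<1+n → term₊-telescopes k (ℕₚ.≤-pred k<1+n))) ⟩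
    Σ₀ (suc n) (λ k → term k + (w k - w (suc k))) + term₊ (suc n)
      ≈⟨ +-congʳ (Σ₀-+ (suc n) _ _) ⟩
    (Σ₀ (suc n) term + Σ₀ (suc n) (λ k → w k - w (suc k))) + term₊ (suc n)
      ≈⟨ +-cong (+-cong (shanks n s m) (Σ₀-telescope (suc n) w)) (*-congˡ (shift-cong (pentagonal⁺ (suc n))
         (empty-product (suc n)) m)) ⟩
    (pentagonalSum n s m + (0# - (- σ) * shift (pentagonal⁻ (suc n)) (eulerFactors n (n ∸ n) s) m)) + σ * x⁺
      ≈⟨ +-congʳ (+-congˡ (+-congˡ (-‿cong (*-congˡ (shift-cong (pentagonal⁻ (suc n)) (empty-product n) m))))) ⟩
    (pentagonalSum n s m + (0# - (- σ) * x⁻)) + σ * x⁺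
      ≈⟨ solve 5 (λ u v σ a b → ((u :+ v) :+ (con (ℤ.+ 0) :- (:- σ) :* a)) :+ σ :* b := u :+ (v :+ σ :* (a :+ b))) refl
         (s m) _ σ x⁻ x⁺ ⟩
    pentagonalSum (suc n) s m ∎
    where
    open ShanksStep n s m
    σ x⁻ x⁺ : Carrier
    σ = sgn (suc n)
    x⁻ = shift (pentagonal⁻ (suc n)) s m
    x⁺ = shift (pentagonal⁺ (suc n)) s m
    empty-product : ∀ k → eulerFactors k (n ∸ n) s ≐ s
    empty-product k rewrite ℕₚ.n∸n≡0 n = λ _ → refl

  shanksSum-low : ∀ n s t → t ≤ n → shanksSum n s t ≈ eulerFactors 0 n s t
  shanksSum-low n s t t≤n = begin
    shanksSum n s t
      ≈⟨ Σ₀-shift n _ ⟩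
    1# * shift (shanksExponent n 0) (eulerFactors 0 n s) t + Σ₀ n _
      ≈⟨ +-cong (*-identityˡ _) (Σ₀-zero n (λ k _ → trans (*-congˡ (shift-vanishes (shanksExponent n (suc k))
         (eulerFactors (suc k) (n ∸ suc k) s) t (t<exp k))) (zeroʳ _))) ⟩
    shift (shanksExponent n 0) (eulerFactors 0 n s) t + 0#
      ≈⟨ +-identityʳ _ ⟩
    shift (shanksExponent n 0) (eulerFactors 0 n s) t
      ≈⟨ shift-congˡ (eulerFactors 0 n s) t (≡.trans (ℕₚ.+-identityʳ _) (ℕₚ.*-zeroʳ n)) ⟩
    eulerFactors 0 n s t ∎
    where
    t<exp : ∀ k → t < shanksExponent n (suc k)
    t<exp k = ℕₚ.≤-trans (s≤s t≤n) (ℕₚ.≤-trans (ℕₚ.≤-reflexive (ℕₚ.+-comm 1 n))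
      (ℕₚ.+-mono-≤ (ℕₚ.m≤m*n n (suc k)) (ℕₚ.≤-trans (s≤s z≤n) (ℕₚ.m≤n+m (suc k) (triangle k)))))

  boundedPartitions : ℕ → Series
  boundedPartitions k t = natR R (partsLe k t)

  partitions : Series
  partitions t = natR R (partition t)

  natR-if : (a? : Dec A) (x : ℕ) → natR R (if does a? then x else 0) ≈ when a? (natR R x)
  natR-if (yes _) x = refl
  natR-if (no _)  x = refl

  oneMinus-boundedPartitions : ∀ k → oneMinus (suc k) (boundedPartitions (suc k)) ≐ boundedPartitions k
  oneMinus-boundedPartitions k t = begin
    natR R (partsLe (suc k) t) - x
      ≡⟨ ≡.cong (λ p → natR R p - x) (BoundedPartitions.partsLe-suc k t) ⟩
    natR R (partsLe k t ℕ.+ _) - x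
      ≈⟨ +-congʳ (trans (natR-+ (partsLe k t) _) (+-congˡ (natR-if (suc k ≤? t) _))) ⟩
    (boundedPartitions k t + x) - x
      ≈⟨ trans (+-assoc _ _ _) (trans (+-congˡ (-‿inverseʳ _)) (+-identityʳ _)) ⟩
    boundedPartitions k t ∎
    where
    x : Carrier
    x = shift (suc k) (boundedPartitions (suc k)) t

  eulerFactors-boundedPartitions : ∀ d → eulerFactors 0 d (boundedPartitions d) ≐ boundedPartitions 0
  eulerFactors-boundedPartitions zero    t = refl
  eulerFactors-boundedPartitions (suc d) t = begin
    eulerFactors 0 (suc d) (boundedPartitions (suc d)) t
      ≈⟨ eulerFactors-suc 0 d _ t ⟩
    oneMinus (suc d) (eulerFactors 0 d (boundedPartitions (suc d))) t
      ≈⟨ eulerFactors-oneMinus 0 d (suc d) _ t ⟨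
    eulerFactors 0 d (oneMinus (suc d) (boundedPartitions (suc d))) t
      ≈⟨ eulerFactors-cong 0 d (oneMinus-boundedPartitions d) t ⟩
    eulerFactors 0 d (boundedPartitions d) t
      ≈⟨ eulerFactors-boundedPartitions d t ⟩
    boundedPartitions 0 t ∎

  pentagonalSum-local : ∀ N s s′ t → (∀ t′ → t′ ≤ t → s t′ ≈ s′ t′) → pentagonalSum N s t ≈ pentagonalSum N s′ t
  pentagonalSum-local N s s′ t s≈s′ = +-cong (s≈s′ t ℕₚ.≤-refl) (Σ₁-cong N (λ j →
      *-congˡ (+-cong (local (pentagonal⁻ j)) (local (pentagonal⁺ j)))))
    where
    local : ∀ a → shift a s t ≈ shift a s′ t
    local a = when-cong (a ≤? t) (λ _ → s≈s′ (t ∸ a) (ℕₚ.m∸n≤m t a))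

  pentagonalSum-partitions : ∀ N t → t ≤ N → pentagonalSum N partitions t ≈ boundedPartitions 0 t
  pentagonalSum-partitions N t t≤N = begin
    pentagonalSum N partitions t
      ≈⟨ pentagonalSum-local N partitions (boundedPartitions N) t
         (λ t′ t′≤t → reflexive (≡.cong (natR R) (≡.sym (BoundedPartitions.partsLe-stable (ℕₚ.≤-trans t′≤t t≤N))))) ⟩
    pentagonalSum N (boundedPartitions N) t
      ≈⟨ shanks N (boundedPartitions N) t ⟨
    shanksSum N (boundedPartitions N) t
      ≈⟨ shanksSum-low N (boundedPartitions N) t t≤N ⟩
    eulerFactors 0 N (boundedPartitions N) t
      ≈⟨ eulerFactors-boundedPartitions N t ⟩
    boundedPartitions 0 t ∎

  infixl 7 _⊛_
  _⊛_ : Series → Series → Series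
  (a ⊛ b) m = Σ₀ (suc m) (λ k → a k * b (m ∸ k))

  ⊛-comm : ∀ a b m → (a ⊛ b) m ≈ (b ⊛ a) m
  ⊛-comm a b m = begin
    Σ₀ (suc m) (λ k → a k * b (m ∸ k))
      ≈⟨ Σ₀-reverse m _ ⟨
    Σ₀ (suc m) (λ k → a (m ∸ k) * b (m ∸ (m ∸ k)))
      ≈⟨ Σ₀-cong-on (suc m) (λ k k<1+m → trans (*-comm _ _)
         (*-congʳ (reflexive (≡.cong b (ℕₚ.m∸[m∸n]≡n (ℕₚ.≤-pred k<1+m)))))) ⟩
    Σ₀ (suc m) (λ k → b k * a (m ∸ k)) ∎

  ⊛-congʳ-on : ∀ a b b′ m → (∀ t → t ≤ m → b t ≈ b′ t) → (a ⊛ b) m ≈ (a ⊛ b′) m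
  ⊛-congʳ-on a b b′ m b≈b′ = Σ₀-cong (suc m) (λ k → *-congˡ (b≈b′ (m ∸ k) (ℕₚ.m∸n≤m m k)))

  ⊛-+ʳ : ∀ a b b′ m → (a ⊛ (λ t → b t + b′ t)) m ≈ (a ⊛ b) m + (a ⊛ b′) m
  ⊛-+ʳ a b b′ m = trans (Σ₀-cong (suc m) (λ _ → distribˡ _ _ _)) (Σ₀-+ (suc m) _ _)

  ⊛-*ʳ : ∀ a x b m → (a ⊛ (λ t → x * b t)) m ≈ x * (a ⊛ b) m
  ⊛-*ʳ a x b m = trans (Σ₀-cong (suc m) (λ _ → trans (sym (*-assoc _ _ _)) (trans (*-congʳ (*-comm _ _))
      (*-assoc _ _ _)))) (sym (Σ₀-*ˡ (suc m) x _))

  ⊛-Σ₁ʳ : ∀ a N (b : ℕ → Series) m → (a ⊛ (λ t → Σ₁ N (λ j → b j t))) m ≈ Σ₁ N (λ j → (a ⊛ b j) m)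
  ⊛-Σ₁ʳ a N b m = trans (Σ₀-cong (suc m) (λ _ → Σ₁-*ˡ N _ _)) (Σ₀-Σ₁ (suc m) N _)

  ⊛-shiftʳ : ∀ a e b m → (a ⊛ shift e b) m ≈ shift e (a ⊛ b) m
  ⊛-shiftʳ a e b m = split (e ≤? m)
    where
    term : ℕ → Carrier
    term k = a k * shift e b (m ∸ k)

    ∸-swap : ∀ {x y} → x ≤ m ∸ y → y ≤ m → y ≤ m ∸ x
    ∸-swap {x} {y} x≤m-y y≤m = ≡.subst (_≤ m ∸ x) (ℕₚ.m+n∸m≡n x y)
      (ℕₚ.∸-monoˡ-≤ x (≡.subst (x ℕ.+ y ≤_) (ℕₚ.m∸n+n≡m y≤m) (ℕₚ.+-monoˡ-≤ y x≤m-y)))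

    split : (e≤?m : Dec (e ≤ m)) → Σ₀ (suc m) term ≈ when e≤?m ((a ⊛ b) (m ∸ e))
    split (no e≰m)  = Σ₀-zero (suc m) (λ k _ → trans (*-congˡ (when-no (e ≤? m ∸ k) (λ e≤m-k →
        e≰m (ℕₚ.≤-trans e≤m-k (ℕₚ.m∸n≤m m k))))) (zeroʳ _))
    split (yes e≤m) = sym (begin
      Σ₀ (suc (m ∸ e)) (λ k → a k * b (m ∸ e ∸ k))   ≈⟨ Σ₀-cong-on (suc (m ∸ e)) (λ k k<1+m-e → *-congˡ (sym (trans
          (when-yes (e ≤? m ∸ k) (∸-swap (ℕₚ.≤-pred k<1+m-e) e≤m)) (reflexive (≡.cong b (∸-comm k)))))) ⟩
      Σ₀ (suc (m ∸ e)) term                           ≈⟨ Σ₀-pad (suc m) (s≤s (ℕₚ.m∸n≤m m e)) (λ k m-e<k k≤m → trans (*-congˡ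
          (when-no (e ≤? m ∸ k) (λ e≤m-k → ℕₚ.<⇒≱ m-e<k (∸-swap e≤m-k (ℕₚ.≤-pred k≤m))))) (zeroʳ _)) ⟩
      Σ₀ (suc m) term                                 ∎)
      where
      ∸-comm : ∀ k → m ∸ k ∸ e ≡ m ∸ e ∸ k
      ∸-comm k = ≡.trans (ℕₚ.∸-+-assoc m k e) (≡.trans (≡.cong (m ∸_) (ℕₚ.+-comm k e)) (≡.sym (ℕₚ.∸-+-assoc m e k)))

  ⊛-pentagonalSumʳ : ∀ a N b m → (a ⊛ pentagonalSum N b) m ≈ pentagonalSum N (a ⊛ b) m
  ⊛-pentagonalSumʳ a N b m = begin
    (a ⊛ pentagonalSum N b) m
      ≈⟨ ⊛-+ʳ a b (λ t → Σ₁ N (λ j → sgn j * (x⁻ j b t + x⁺ j b t))) m ⟩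
    (a ⊛ b) m + (a ⊛ (λ t → Σ₁ N (λ j → sgn j * (x⁻ j b t + x⁺ j b t)))) m
      ≈⟨ +-congˡ (⊛-Σ₁ʳ a N (λ j t → sgn j * (x⁻ j b t + x⁺ j b t)) m) ⟩
    (a ⊛ b) m + Σ₁ N (λ j → (a ⊛ (λ t → sgn j * (x⁻ j b t + x⁺ j b t))) m)
      ≈⟨ +-congˡ (Σ₁-cong N (λ j → trans (⊛-*ʳ a (sgn j) (λ t → x⁻ j b t + x⁺ j b t) m) (*-congˡ
         (trans (⊛-+ʳ a (x⁻ j b) (x⁺ j b) m) (+-cong (⊛-shiftʳ a (pentagonal⁻ j) b m) (⊛-shiftʳ a (pentagonal⁺ j) b m)))))) ⟩
    pentagonalSum N (a ⊛ b) m ∎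
    where
    x⁻ x⁺ : ℕ → Series → Series
    x⁻ j = shift (pentagonal⁻ j)
    x⁺ j = shift (pentagonal⁺ j)

  ⊛-identityʳ : ∀ a m → (a ⊛ boundedPartitions 0) m ≈ a m
  ⊛-identityʳ a m = begin
    (a ⊛ boundedPartitions 0) m
      ≈⟨ Σ₀-single (suc m) m ℕₚ.≤-refl (λ i i<1+m i≢m → trans (*-congˡ (vanishes i (ℕₚ.≤∧≢⇒< (ℕₚ.≤-pred i<1+m) i≢m)))
         (zeroʳ _)) ⟩
    a m * boundedPartitions 0 (m ∸ m)
      ≡⟨ ≡.cong (λ t → a m * boundedPartitions 0 t) (ℕₚ.n∸n≡0 m) ⟩
    a m * (1# + 0#)
      ≈⟨ trans (*-congˡ (+-identityʳ _)) (*-identityʳ _) ⟩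
    a m ∎
    where
    vanishes : ∀ i → i < m → boundedPartitions 0 (m ∸ i) ≈ 0#
    vanishes i i<m = reflexive (≡.cong (boundedPartitions 0) (ℕₚ.+-∸-assoc 1 i<m))

  pentagonalSum-⊛-partitions : ∀ h N m → m ≤ N → (pentagonalSum N h ⊛ partitions) m ≈ h m
  pentagonalSum-⊛-partitions h N m m≤N = begin
    (pentagonalSum N h ⊛ partitions) m
      ≈⟨ ⊛-comm _ partitions m ⟩
    (partitions ⊛ pentagonalSum N h) m
      ≈⟨ ⊛-pentagonalSumʳ partitions N h m ⟩
    pentagonalSum N (partitions ⊛ h) m
      ≈⟨ pentagonalSum-local N _ _ m (λ t _ → ⊛-comm partitions h t) ⟩
    pentagonalSum N (h ⊛ partitions) m
      ≈⟨ ⊛-pentagonalSumʳ h N partitions m ⟨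
    (h ⊛ pentagonalSum N partitions) m
      ≈⟨ ⊛-congʳ-on h _ _ m (λ t t≤m → pentagonalSum-partitions N t (ℕₚ.≤-trans t≤m m≤N)) ⟩
    (h ⊛ boundedPartitions 0) m
      ≈⟨ ⊛-identityʳ h m ⟩
    h m ∎

  h∸≈shift : ∀ (h : Series) → h 0 ≈ 0# → ∀ a k → h (k ∸ a) ≈ shift a h k
  h∸≈shift h h0≈0 a k = split (a ≤? k)
    where
    split : (a≤?k : Dec (a ≤ k)) → h (k ∸ a) ≈ when a≤?k (h (k ∸ a))
    split (yes _)   = refl
    split (no a≰k)  = trans (reflexive (≡.cong h (ℕₚ.m≤n⇒m∸n≡0 (ℕₚ.<⇒≤ (ℕₚ.≰⇒> a≰k))))) h0≈0

  H≈pentagonalSum : ∀ h → h 0 ≈ 0# → ∀ N k → k ≤ N → H R h k ≈ pentagonalSum N h k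
  H≈pentagonalSum h h0≈0 N k k≤N = begin
    h k + (Σ₁ (bound+ R k) (λ j → sgn j * h (k ∸ pent+ R j)) + Σ₁ (bound- R k) (λ j → sgn j * h (k ∸ pent- R j)))
      ≈⟨ +-congˡ (+-cong (Σ₁-cong (bound+ R k) (λ j → *-congˡ (to-shift (pent+≡pentagonal⁺ R j))))
         (Σ₁-cong (bound- R k) (λ j → *-congˡ (to-shift (pent-≡pentagonal⁻ R j))))) ⟩
    h k + (Σ₁ (bound+ R k) term⁺ + Σ₁ (bound- R k) term⁻)
      ≈⟨ +-congˡ (+-cong (Σ₁-pad-both (bound+ R k) N beyond-bound+ (beyond-N pentagonal⁺ j≤pentagonal⁺))
         (Σ₁-pad-both (bound- R k) N beyond-bound- (beyond-N pentagonal⁻ j≤pentagonal⁻))) ⟩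
    h k + (Σ₁ N term⁺ + Σ₁ N term⁻)
      ≈⟨ +-congˡ (trans (+-comm _ _) (trans (sym (Σ₁-+ N term⁻ term⁺)) (Σ₁-cong N (λ _ → sym (distribˡ _ _ _))))) ⟩
    pentagonalSum N h k ∎
    where
    term⁺ term⁻ : ℕ → Carrier
    term⁺ j = sgn j * shift (pentagonal⁺ j) h k
    term⁻ j = sgn j * shift (pentagonal⁻ j) h k

    to-shift : ∀ {a b} → a ≡ b → h (k ∸ a) ≈ shift b h k
    to-shift {a} ≡.refl = h∸≈shift h h0≈0 a k

    vanishes : ∀ a j → k < a → sgn j * shift a h k ≈ 0#
    vanishes a j k<a = trans (*-congˡ (shift-vanishes a h k k<a)) (zeroʳ _)

    beyond-bound+ : ∀ j → bound+ R k < j → term⁺ j ≈ 0#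
    beyond-bound+ j b<j = vanishes _ j (ℕₚ.≰⇒> (λ p≤k → ℕₚ.<⇒≱ b<j (pentagonal⁺-≤⇒≤bound+ R j k p≤k)))

    beyond-bound- : ∀ j → bound- R k < j → term⁻ j ≈ 0#
    beyond-bound- (suc i) b<j = vanishes _ (suc i) (ℕₚ.≰⇒> (λ p≤k → ℕₚ.<⇒≱ b<j (pentagonal⁻-≤⇒≤bound- R i k p≤k)))

    beyond-N : ∀ (p : ℕ → ℕ) → (∀ j → j ≤ p j) → ∀ j → N < j → sgn j * shift (p j) h k ≈ 0#
    beyond-N p j≤p j N<j = vanishes (p j) j (ℕₚ.<-≤-trans (ℕₚ.≤-<-trans k≤N N<j) (j≤p j))

  partition-inversion : ∀ h → h 0 ≈ 0# → ∀ N m → m ≤ N → Σ₁ N (λ k → H R h k * pₖ R k m) ≈ h m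
  partition-inversion h h0≈0 N m m≤N = begin
    Σ₁ N (λ k → H R h k * pₖ R k m)
      ≈⟨ Σ₁-pad N m≤N (λ k m<k _ → trans (*-congˡ (when-no (k ≤? m) (ℕₚ.<⇒≱ m<k))) (zeroʳ _)) ⟨
    Σ₁ m (λ k → H R h k * pₖ R k m)
      ≈⟨ +-identityˡ _ ⟨
    0# + Σ₁ m (λ k → H R h k * pₖ R k m)
      ≈⟨ +-congʳ H0≈0 ⟨
    H R h 0 * pₖ R 0 m + Σ₁ m (λ k → H R h k * pₖ R k m)
      ≈⟨ Σ₀≈Σ₁ m _ ⟨
    Σ₀ (suc m) (λ k → H R h k * pₖ R k m)
      ≈⟨ Σ₀-cong-on (suc m) (λ k k<1+m → *-cong
         (H≈pentagonalSum h h0≈0 N k (ℕₚ.≤-trans (ℕₚ.≤-pred k<1+m) m≤N))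
         (when-yes (k ≤? m) (ℕₚ.≤-pred k<1+m))) ⟩
    (pentagonalSum N h ⊛ partitions) m
      ≈⟨ pentagonalSum-⊛-partitions h N m m≤N ⟩
    h m ∎
    where
    H0≈0 : H R h 0 * pₖ R 0 m ≈ 0#
    H0≈0 = trans (*-congʳ (trans (+-cong h0≈0 (+-identityʳ 0#)) (+-identityʳ 0#))) (zeroˡ _)

  ⋆-partition-expansion : ∀ h → h 0 ≈ 0# → ∀ b N n → 1 ≤ n → n ≤ N → (h ⋆ b) n ≈ Σ₁ N (λ k → H R h k * (pₖ R k ⋆ b) n)
  ⋆-partition-expansion h h0≈0 b N n 1≤n n≤N = begin
    (h ⋆ b) n
      ≈⟨ ⋆-cong-on n 1≤n (λ d _ d≤n → sym (partition-inversion h h0≈0 N d (ℕₚ.≤-trans d≤n n≤N))) (λ _ _ _ → refl) ⟩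
    ((λ d → Σ₁ N (λ k → H R h k * pₖ R k d)) ⋆ b) n
      ≈⟨ ⋆-Σ₁ˡ N (H R h) (pₖ R) b n ⟩
    Σ₁ N (λ k → H R h k * (pₖ R k ⋆ b) n) ∎

  ⋆⋆-partition-expansion : ∀ h → h 0 ≈ 0# → ∀ a b N n → 1 ≤ n → n ≤ N →
    ((h ⋆ a) ⋆ b) n ≈ Σ₁ N (λ k → H R h k * ((pₖ R k ⋆ a) ⋆ b) n)
  ⋆⋆-partition-expansion h h0≈0 a b N n 1≤n n≤N = begin
    ((h ⋆ a) ⋆ b) n
      ≈⟨ ⋆-cong-on n 1≤n (λ m 1≤m m≤n → ⋆-partition-expansion h h0≈0 a N m 1≤m (ℕₚ.≤-trans m≤n n≤N)) (λ _ _ _ → refl) ⟩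
    ((λ m → Σ₁ N (λ k → H R h k * (pₖ R k ⋆ a) m)) ⋆ b) n
      ≈⟨ ⋆-Σ₁ˡ N (H R h) (λ k → pₖ R k ⋆ a) b n ⟩
    Σ₁ N (λ k → H R h k * ((pₖ R k ⋆ a) ⋆ b) n) ∎

  ⋆-rotate : ∀ a b c n → 1 ≤ n → (a ⋆ (b ⋆ c)) n ≈ ((b ⋆ a) ⋆ c) n
  ⋆-rotate a b c n 1≤n = trans (sym (⋆-assoc a b c n 1≤n)) (⋆-cong-on n 1≤n (λ d 1≤d _ → ⋆-comm a b d 1≤d) (λ _ _ _ → refl))

open Defs using (Σ₁; _⋆_; μ; pₖ; D; H)

corollary4p4 : {c ℓ : Level} (R : CommutativeRing c ℓ) (f g h : ℕ → CommutativeRing.Carrier R) →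
    CommutativeRing._≈_ R (f 1) (CommutativeRing.1# R) →
    CommutativeRing._≈_ R (h 0) (CommutativeRing.0# R) →
    (∀ n → n ≥ 1 → CommutativeRing._≈_ R (_⋆_ R f g n) (_⋆_ R h (μ R) n)) →
    ∀ n → n ≥ 1 →
      CommutativeRing._≈_ R (g n)
        (Σ₁ R n (λ k → CommutativeRing._*_ R
           (CommutativeRing._+_ R (_⋆_ R (pₖ R k) (μ R) n) (_⋆_ R (_⋆_ R (pₖ R k) (D R f)) (μ R) n))
           (H R h k)))
corollary4p4 R f g h f1≈1 h0≈0 f⋆g≈h⋆μ n 1≤n = begin
  g n
    ≈⟨ ⋆-solution f g (h ∗ μ R) f1≈1 f⋆g≈h⋆μ n 1≤n ⟩
  (h ∗ μ R) n + (D R f ∗ (h ∗ μ R)) n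
    ≈⟨ +-congˡ (⋆-rotate (D R f) h (μ R) n 1≤n) ⟩
  (h ∗ μ R) n + ((h ∗ D R f) ∗ μ R) n
    ≈⟨ +-cong (⋆-partition-expansion h h0≈0 (μ R) n n 1≤n ℕₚ.≤-refl)
       (⋆⋆-partition-expansion h h0≈0 (D R f) (μ R) n n 1≤n ℕₚ.≤-refl) ⟩
  ∑ n (λ k → H R h k * (pₖ R k ∗ μ R) n) + ∑ n (λ k → H R h k * ((pₖ R k ∗ D R f) ∗ μ R) n)
    ≈⟨ Σ₁-+ n _ _ ⟨
  ∑ n (λ k → H R h k * (pₖ R k ∗ μ R) n + H R h k * ((pₖ R k ∗ D R f) ∗ μ R) n)
    ≈⟨ Σ₁-cong n (λ _ → trans (sym (distribˡ _ _ _)) (*-comm _ _)) ⟩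
  ∑ n (λ k → ((pₖ R k ∗ μ R) n + ((pₖ R k ∗ D R f) ∗ μ R) n) * H R h k) ∎
  where
  open CommutativeRing R
  open RingValued R renaming (_⋆_ to _∗_; Σ₁ to ∑)
  open import Relation.Binary.Reasoning.Setoid setoid
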